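{- Let $G$ be a finite simple graph of order $n\geq 3$. Then $\gamma_{\rm ri2}(G)=n-1$ if and only if $G$ has one connected component $G_1$, with $n_1=|V(G_1)|$, that is isomorphic to one of $S_{n_1-1}$ (with $n_1\geq 3$), $S_{n_1-1}^+$ (with $n_1\geq 3$), $S(n_1-3,1)$ (with $n_1\geq 4$), and $C_5$, and all other connected components of $G$ are isomorphic to $K_1$ or $K_2$.
   Context: A $2$-rainbow independent dominating function (2RiDF) of a graph $G$ is a function $f: V(G)\to\{0,1,2\}$ such that, writing $V_i=\{v: f(v)=i\}$, for each $i\in\{1,2\}$ the set $V_i$ is independent and every vertex $v$ with $f(v)=0$ has a neighbor $u$ with $f(u)=i$. Its weight is the number of vertices with nonzero value, and $\gamma_{\rm ri2}(G)$ is the minimum weight of a 2RiDF of $G$. The star $S_m$ ($m\geq 1$) is $K_{1,m}$. $S_m^+$ is the graph obtained from $S_m$ by adding a single edge (necessarily joining two leaves). For integers $n\geq m\geq 0$, the double star $S(n,m)$ has vertex set $\{u_0,\ldots,u_n,v_0,\ldots,v_m\}$ and edge set $\{u_0v_0\}\cup\{u_0u_i: 1\le i\le n\}\cup\{v_0v_j:1\le j\le m\}$. $C_5$ is the $5$-cycle; $K_1,K_2$ are complete graphs on $1$ and $2$ vertices. -}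

module Defs where

open import Data.Nat using (ℕ; zero; suc; _+_; _≤_; _%_)
open import Data.Nat using () renaming (_≡ᵇ_ to _==_)
open import Data.Fin using (Fin; zero; suc; toℕ; splitAt)
open import Data.Bool using (Bool; true; false; _∨_)
open import Data.Bool.Properties using (∨-comm)
open import Data.Sum using (_⊎_; inj₁; inj₂)
open import Data.Product using (Σ; _×_; _,_; ∃)
open import Data.List using (List; map; allFin)
open import Data.Nat.ListAction using (sum)
open import Relation.Binary.PropositionalEquality using (_≡_; _≢_; refl)
open import Relation.Nullary using (¬_)
open import Function.Definitions using (Injective)

record Graph (n : ℕ) : Set where
  field
    adj    : Fin n → Fin n → Bool
    sym    : ∀ u v → adj u v ≡ adj v u
    irrefl : ∀ v → adj v v ≡ false
open Graph public

-- 2-rainbow independent dominating functions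
-- f : V(G) → {0,1,2}, encoded as Fin 3 (Fin.zero is the value 0;
-- the values 1,2 are the two nonzero elements of Fin 3).

IndependentClass : ∀ {n} → Graph n → (Fin n → Fin 3) → Fin 3 → Set
IndependentClass G f i = ∀ u v → adj G u v ≡ true → f u ≡ i → f v ≢ i

DominatesZeros : ∀ {n} → Graph n → (Fin n → Fin 3) → Fin 3 → Set
DominatesZeros {n} G f i =
  ∀ v → f v ≡ zero → Σ (Fin n) λ u → adj G v u ≡ true × f u ≡ i

Is2RiDF : ∀ {n} → Graph n → (Fin n → Fin 3) → Set
Is2RiDF G f = ∀ (i : Fin 3) → i ≢ zero →
  IndependentClass G f i × DominatesZeros G f i

nonzero : Fin 3 → ℕ
nonzero zero    = 0
nonzero (suc _) = 1

weight : ∀ {n} → (Fin n → Fin 3) → ℕ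
weight {n} f = sum (map (λ v → nonzero (f v)) (allFin n))

γri2≡ : ∀ {n} → Graph n → ℕ → Set
γri2≡ {n} G k =
  (Σ (Fin n → Fin 3) λ f → Is2RiDF G f × weight f ≡ k) ×
  (∀ (f : Fin n → Fin 3) → Is2RiDF G f → k ≤ weight f)

data Reach {n} (G : Graph n) (u : Fin n) : Fin n → Set where
  here : Reach G u u
  step : ∀ {v w} → Reach G u v → adj G v w ≡ true → Reach G u w

-- The connected component of G containing v is isomorphic to H
-- (the component is the subgraph induced by the vertices reachable from v)
ComponentIso : ∀ {n m} → Graph n → Fin n → Graph m → Set
ComponentIso {n} {m} G v H =
  Σ (Fin m → Fin n) λ φ →
    Injective _≡_ _≡_ φ ×
    (∀ i → Reach G v (φ i)) ×
    (∀ u → Reach G v u → Σ (Fin m) λ i → φ i ≡ u) ×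
    (∀ i j → adj H i j ≡ adj G (φ i) (φ j))

K₁ : Graph 1
K₁ = record { adj = λ _ _ → false ; sym = λ _ _ → refl ; irrefl = λ _ → refl }

k2adj : Fin 2 → Fin 2 → Bool
k2adj zero (suc zero) = true
k2adj (suc zero) zero = true
k2adj _ _ = false

K₂ : Graph 2
K₂ = record { adj = k2adj ; sym = s ; irrefl = r }
  where
  s : ∀ u v → k2adj u v ≡ k2adj v u
  s zero zero = refl
  s zero (suc zero) = refl
  s (suc zero) zero = refl
  s (suc zero) (suc zero) = refl
  r : ∀ v → k2adj v v ≡ false
  r zero = refl
  r (suc zero) = refl

-- Star S_m = K_{1,m} on Fin (suc m); centre is zero, leaves are suc i
staradj : ∀ {m} → Fin (suc m) → Fin (suc m) → Bool
staradj zero (suc _) = true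
staradj (suc _) zero = true
staradj _ _ = false

Star : (m : ℕ) → Graph (suc m)
Star m = record { adj = staradj ; sym = s ; irrefl = r }
  where
  s : ∀ u v → staradj {m} u v ≡ staradj v u
  s zero zero = refl
  s zero (suc _) = refl
  s (suc _) zero = refl
  s (suc _) (suc _) = refl
  r : ∀ v → staradj {m} v v ≡ false
  r zero = refl
  r (suc _) = refl

-- S^+_{k+2}: the star S_{k+2} (on Fin (3 + k)) with the extra edge
-- joining the two leaves 1 and 2.
starPlusAdj : ∀ {k} → Fin (3 + k) → Fin (3 + k) → Bool
starPlusAdj zero (suc _) = true
starPlusAdj (suc _) zero = true
starPlusAdj (suc zero) (suc (suc zero)) = true
starPlusAdj (suc (suc zero)) (suc zero) = true
starPlusAdj _ _ = false

StarPlus : (k : ℕ) → Graph (3 + k)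
StarPlus k = record { adj = starPlusAdj ; sym = s ; irrefl = r }
  where
  s : ∀ u v → starPlusAdj {k} u v ≡ starPlusAdj v u
  s zero zero = refl
  s zero (suc _) = refl
  s (suc _) zero = refl
  s (suc zero) (suc zero) = refl
  s (suc zero) (suc (suc zero)) = refl
  s (suc zero) (suc (suc (suc _))) = refl
  s (suc (suc zero)) (suc zero) = refl
  s (suc (suc zero)) (suc (suc zero)) = refl
  s (suc (suc zero)) (suc (suc (suc _))) = refl
  s (suc (suc (suc _))) (suc zero) = refl
  s (suc (suc (suc _))) (suc (suc zero)) = refl
  s (suc (suc (suc _))) (suc (suc (suc _))) = refl
  r : ∀ v → starPlusAdj {k} v v ≡ false
  r zero = refl
  r (suc zero) = refl
  r (suc (suc zero)) = refl
  r (suc (suc (suc _))) = refl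

-- Double star S(a,b): vertices u_0..u_a (inj₁) and v_0..v_b (inj₂),
-- encoded on Fin (suc a + suc b) via splitAt.
dsAdj : ∀ {a b} → Fin (suc a) ⊎ Fin (suc b) → Fin (suc a) ⊎ Fin (suc b) → Bool
dsAdj (inj₁ zero) (inj₂ zero) = true
dsAdj (inj₂ zero) (inj₁ zero) = true
dsAdj (inj₁ zero) (inj₁ (suc _)) = true
dsAdj (inj₁ (suc _)) (inj₁ zero) = true
dsAdj (inj₂ zero) (inj₂ (suc _)) = true
dsAdj (inj₂ (suc _)) (inj₂ zero) = true
dsAdj _ _ = false

dsSym : ∀ {a b} (x y : Fin (suc a) ⊎ Fin (suc b)) → dsAdj x y ≡ dsAdj y x
dsSym (inj₁ zero) (inj₁ zero) = refl
dsSym (inj₁ zero) (inj₁ (suc _)) = refl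
dsSym (inj₁ (suc _)) (inj₁ zero) = refl
dsSym (inj₁ (suc _)) (inj₁ (suc _)) = refl
dsSym (inj₁ zero) (inj₂ zero) = refl
dsSym (inj₁ zero) (inj₂ (suc _)) = refl
dsSym (inj₁ (suc _)) (inj₂ zero) = refl
dsSym (inj₁ (suc _)) (inj₂ (suc _)) = refl
dsSym (inj₂ zero) (inj₁ zero) = refl
dsSym (inj₂ zero) (inj₁ (suc _)) = refl
dsSym (inj₂ (suc _)) (inj₁ zero) = refl
dsSym (inj₂ (suc _)) (inj₁ (suc _)) = refl
dsSym (inj₂ zero) (inj₂ zero) = refl
dsSym (inj₂ zero) (inj₂ (suc _)) = refl
dsSym (inj₂ (suc _)) (inj₂ zero) = refl
dsSym (inj₂ (suc _)) (inj₂ (suc _)) = refl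

dsIrr : ∀ {a b} (x : Fin (suc a) ⊎ Fin (suc b)) → dsAdj x x ≡ false
dsIrr (inj₁ zero) = refl
dsIrr (inj₁ (suc _)) = refl
dsIrr (inj₂ zero) = refl
dsIrr (inj₂ (suc _)) = refl

DoubleStar : (a b : ℕ) → Graph (suc a + suc b)
DoubleStar a b = record
  { adj = λ x y → dsAdj (splitAt (suc a) x) (splitAt (suc a) y)
  ; sym = λ x y → dsSym (splitAt (suc a) x) (splitAt (suc a) y)
  ; irrefl = λ x → dsIrr (splitAt (suc a) x)
  }

c5adj : Fin 5 → Fin 5 → Bool
c5adj i j = (((toℕ i + 1) % 5) == toℕ j) ∨ (((toℕ j + 1) % 5) == toℕ i)

C₅ : Graph 5
C₅ = record { adj = c5adj ; sym = λ i j → ∨-comm (((toℕ i + 1) % 5) == toℕ j) (((toℕ j + 1) % 5) == toℕ i) ; irrefl = r }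
  where
  r : ∀ v → c5adj v v ≡ false
  r zero = refl
  r (suc zero) = refl
  r (suc (suc zero)) = refl
  r (suc (suc (suc zero))) = refl
  r (suc (suc (suc (suc zero)))) = refl

-- The component containing v is isomorphic to S_{n1-1} (n1 ≥ 3),
-- S^+_{n1-1} (n1 ≥ 3), S(n1-3,1) (n1 ≥ 4) or C5.  Here n1 = k + 3 in
-- the first two cases and n1 = k + 4 in the third.
SpecialComponent : ∀ {n} → Graph n → Fin n → Set
SpecialComponent G v =
  (Σ ℕ λ k → ComponentIso G v (Star (2 + k))) ⊎
  (Σ ℕ λ k → ComponentIso G v (StarPlus k)) ⊎
  (Σ ℕ λ k → ComponentIso G v (DoubleStar (1 + k) 1)) ⊎
  ComponentIso G v C₅

Characterisation : ∀ {n} → Graph n → Set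
Characterisation {n} G =
  Σ (Fin n) λ v → SpecialComponent G v ×
    (∀ w → ¬ Reach G v w → ComponentIso G w K₁ ⊎ ComponentIso G w K₂)

-- A 2RiDF has weight n minus its number of zeros, and a zero needs two distinct neighbours
-- (carrying the values 1 and 2). Conversely, prescribed zeros together with prescribed
-- neighbours coloured 1 and 2 extend, by maximal independent sets, to a 2RiDF. Hence
-- γ_ri2(G) = n − 1 exactly when some vertex has two neighbours but no "certificate" exists:
-- no two vertices x ≢ y with neighbours a₁, b₁ of x and a₂, b₂ of y such that {a₁, a₂} and
-- {b₁, b₂} are independent and disjoint from each other.
--
-- In a star, a star with one extra edge and a double star, the neighbourhood of one of any two
-- vertices lies within the other vertex and a single further vertex, which rules out a
-- certificate; C₅ is checked exhaustively; and zeros of a certificate cannot lie in K₁ or K₂.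
-- Conversely, fix a vertex z with two neighbours in a graph without certificate. A vertex with
-- two neighbours outside the component of z would form a certificate with z, so the other
-- components are K₁ or K₂. Inside, either a path z p y q with y at distance two and q ≢ p
-- forces an induced 5-cycle, or every vertex at distance two is a leaf; then all of them hang
-- from a single neighbour p of z and the component is a star, a star plus an edge or a double star.

module Submission where

open import Defs hiding (sym)
open import Data.Nat using (ℕ; zero; suc; _+_; _≤_; _<_; _∸_; z≤n; s≤s; s≤s⁻¹)
open import Data.Nat.Properties
  using (≤-refl; ≤-antisym; ≤-trans; ≤-reflexive; +-mono-≤; +-mono-≤-<; +-suc; 1+n≰n)
open import Data.Fin using (Fin; zero; suc; splitAt; join; _↑ʳ_)
open import Data.Fin.Patterns using (0F; 1F; 2F; 3F; 4F)
open import Data.Fin.Properties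
  using (_≟_; any?; all?; suc-injective; 0≢1+n; join-splitAt; splitAt-join; splitAt-↑ʳ)
open import Data.Bool using (Bool; true; false; _∨_)
open import Data.Bool.Properties using (∨-zeroʳ) renaming (_≟_ to _≟ᵇ_)
open import Data.Sum using (_⊎_; inj₁; inj₂; [_,_]′; swap)
open import Data.Product using (Σ; _×_; _,_; proj₁; proj₂)
open import Data.Empty using (⊥; ⊥-elim)
open import Data.List using (List; []; _∷_; allFin)
open import Data.List.Properties using (map-tabulate)
open import Data.List.Membership.Propositional using (_∈_)
open import Data.List.Membership.Propositional.Properties using (∈-allFin)
open import Data.List.Relation.Unary.Any using (here; there)
open import Data.Nat.ListAction using (sum)
open import Relation.Nullary.Decidable
  using (dec-true; decidable-stable; map′; from-yes; from-no; ¬?; _⊎-dec_)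
open import Function using (_∘_; _$_; id; case_of_)
open import Function.Bundles using (_⇔_; mk⇔)
open import Function.Construct.Composition using (_⇔-∘_)
open import Relation.Binary.PropositionalEquality
  using (_≡_; _≢_; refl; sym; trans; cong; subst; module ≡-Reasoning)
open import Relation.Nullary using (¬_; Dec; yes; no; does; _×-dec_; contradiction)

module Adjacency {n : ℕ} (G : Graph n) where

  Edge : Fin n → Fin n → Set
  Edge u v = adj G u v ≡ true

  edge-sym : ∀ {u v} → Edge u v → Edge v u
  edge-sym {u} {v} e = trans (Graph.sym G v u) e

  edge-irrefl : ∀ {u} → ¬ Edge u u
  edge-irrefl {u} e with () ← trans (sym e) (irrefl G u)

  edge⇒≢ : ∀ {u v} → Edge u v → u ≢ v
  edge⇒≢ e refl = edge-irrefl e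

  edge? : ∀ u v → Dec (Edge u v)
  edge? u v = adj G u v ≟ᵇ true

  ¬edge⇒adj≡false : ∀ {u v} → ¬ Edge u v → adj G u v ≡ false
  ¬edge⇒adj≡false {u} {v} ¬e with adj G u v
  ... | true  = contradiction refl ¬e
  ... | false = refl

  IndependentPair : Fin n → Fin n → Set
  IndependentPair u v = u ≡ v ⊎ ¬ Edge u v

  Degree≥2 : Set
  Degree≥2 = Σ (Fin n) λ x → Σ (Fin n) λ p → Σ (Fin n) λ q → p ≢ q × Edge x p × Edge x q

  independent-pair⇒≢ : ∀ {a b x} → IndependentPair a b → Edge x a → x ≢ b
  independent-pair⇒≢ (inj₁ refl) xa refl = edge-irrefl xa
  independent-pair⇒≢ (inj₂ ¬ab)  xa refl = ¬ab (edge-sym xa)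

  reach-trans : ∀ {u v w} → Reach G u v → Reach G v w → Reach G u w
  reach-trans r here       = r
  reach-trans r (step s e) = step (reach-trans r s) e

  reach-sym : ∀ {u v} → Reach G u v → Reach G v u
  reach-sym here       = here
  reach-sym (step r e) = reach-trans (step here (edge-sym e)) (reach-sym r)

nonzero≤1 : ∀ x → nonzero x ≤ 1
nonzero≤1 zero    = z≤n
nonzero≤1 (suc _) = s≤s z≤n

weight-suc : ∀ {n} (f : Fin (suc n) → Fin 3) →
             weight f ≡ nonzero (f zero) + weight (f ∘ suc)
weight-suc f = cong (λ xs → nonzero (f zero) + sum xs)
  (trans (map-tabulate suc (nonzero ∘ f)) (sym (map-tabulate id (nonzero ∘ f ∘ suc))))

weight≤n : ∀ {n} (f : Fin n → Fin 3) → weight f ≤ n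
weight≤n {zero}  f = z≤n
weight≤n {suc n} f rewrite weight-suc f = +-mono-≤ (nonzero≤1 (f zero)) (weight≤n (f ∘ suc))

≢zero⇒nonzero≡1 : ∀ {x} → x ≢ 0F → nonzero x ≡ 1
≢zero⇒nonzero≡1 {zero}  x≢0 = contradiction refl x≢0
≢zero⇒nonzero≡1 {suc _} _   = refl

no-zero⇒weight≡n : ∀ {n} (f : Fin n → Fin 3) → (∀ x → f x ≢ 0F) → weight f ≡ n
no-zero⇒weight≡n {zero}  f _ = refl
no-zero⇒weight≡n {suc n} f f≢0 rewrite weight-suc f | ≢zero⇒nonzero≡1 (f≢0 zero) =
  cong suc (no-zero⇒weight≡n (f ∘ suc) (f≢0 ∘ suc))

zero⇒weight<n : ∀ {n} (f : Fin n → Fin 3) {x} → f x ≡ 0F → weight f < n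
zero⇒weight<n {suc n} f {zero}  fx≡0 rewrite weight-suc f | fx≡0 = s≤s (weight≤n (f ∘ suc))
zero⇒weight<n {suc n} f {suc x} fx≡0 rewrite weight-suc f =
  +-mono-≤-< (nonzero≤1 (f zero)) (zero⇒weight<n (f ∘ suc) fx≡0)

two-zeros⇒2+weight≤n : ∀ {n} (f : Fin n → Fin 3) {x y} → x ≢ y → f x ≡ 0F → f y ≡ 0F →
                        2 + weight f ≤ n
two-zeros⇒2+weight≤n {suc n} f {zero}  {zero}  x≢y _ _ = contradiction refl x≢y
two-zeros⇒2+weight≤n {suc n} f {zero}  {suc y} _ fx≡0 fy≡0 rewrite weight-suc f | fx≡0 =
  s≤s (zero⇒weight<n (f ∘ suc) fy≡0)
two-zeros⇒2+weight≤n {suc n} f {suc x} {zero}  _ fx≡0 fy≡0 rewrite weight-suc f | fy≡0 =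
  s≤s (zero⇒weight<n (f ∘ suc) fx≡0)
two-zeros⇒2+weight≤n {suc n} f {suc x} {suc y} x≢y fx≡0 fy≡0 rewrite weight-suc f =
  subst (_≤ suc n) (cong suc (+-suc (nonzero (f zero)) (weight (f ∘ suc))))
    (+-mono-≤-< (nonzero≤1 (f zero))
      (two-zeros⇒2+weight≤n (f ∘ suc) (x≢y ∘ cong suc) fx≡0 fy≡0))

one-zero⇒n≤1+weight : ∀ {n} (f : Fin n → Fin 3) →
                       (∀ x y → f x ≡ 0F → f y ≡ 0F → x ≡ y) → n ≤ suc (weight f)
one-zero⇒n≤1+weight {zero}  f _ = z≤n
one-zero⇒n≤1+weight {suc n} f one rewrite weight-suc f with f zero in f0
... | zero  rewrite no-zero⇒weight≡n (f ∘ suc) (λ x fx → 0≢1+n (one zero (suc x) f0 fx)) = ≤-refl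
... | suc _ = s≤s (one-zero⇒n≤1+weight (f ∘ suc)
                    (λ x y fx fy → suc-injective (one (suc x) (suc y) fx fy)))

colour : Bool → Bool → Fin 3
colour true  _     = 1F
colour false true  = 2F
colour false false = 0F

colour≡1⇒first : ∀ a b → colour a b ≡ 1F → a ≡ true
colour≡1⇒first true  _    _ = refl
colour≡1⇒first false true ()

colour≡2⇒second : ∀ a b → colour a b ≡ 2F → b ≡ true
colour≡2⇒second true  _    ()
colour≡2⇒second false true _ = refl

colour≡0⇒neither : ∀ a b → colour a b ≡ 0F → a ≡ false × b ≡ false
colour≡0⇒neither true  _     ()
colour≡0⇒neither false true  ()
colour≡0⇒neither false false _ = refl , refl

¬true⇒false : ∀ {b} → ¬ b ≡ true → b ≡ false
¬true⇒false {true}  ¬b = contradiction refl ¬b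
¬true⇒false {false} _  = refl

∨-introˡ : ∀ {a b} → a ≡ true → (a ∨ b) ≡ true
∨-introˡ refl = refl

∨-introʳ : ∀ a {b} → b ≡ true → (a ∨ b) ≡ true
∨-introʳ a refl = ∨-zeroʳ a

∨-false : ∀ {a b} → a ≡ false → b ≡ false → (a ∨ b) ≡ false
∨-false refl refl = refl

module _ {n : ℕ} (G : Graph n) where
  open Adjacency G

  Independent : (Fin n → Bool) → Set
  Independent S = ∀ u v → S u ≡ true → S v ≡ true → ¬ Edge u v

  HasNeighbourIn : (Fin n → Bool) → Fin n → Set
  HasNeighbourIn S v = Σ (Fin n) λ t → S t ≡ true × Edge v t

  hasNeighbourIn? : ∀ S v → Dec (HasNeighbourIn S v)
  hasNeighbourIn? S v = any? (λ t → (S t ≟ᵇ true) ×-dec edge? v t)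

  insert : Fin n → (Fin n → Bool) → Fin n → Bool
  insert v S u with u ≟ v
  ... | yes _ = true
  ... | no  _ = S u

  insert-here : ∀ v S → insert v S v ≡ true
  insert-here v S with v ≟ v
  ... | yes _   = refl
  ... | no  v≢v = contradiction refl v≢v

  insert-⊇ : ∀ v S u → S u ≡ true → insert v S u ≡ true
  insert-⊇ v S u Su with u ≟ v
  ... | yes _ = refl
  ... | no  _ = Su

  insert-inv : ∀ v S u → insert v S u ≡ true → u ≡ v ⊎ S u ≡ true
  insert-inv v S u h with u ≟ v
  ... | yes u≡v = inj₁ u≡v
  ... | no  _   = inj₂ h

  record Extension (forbidden S : Fin n → Bool) (vs : List (Fin n)) (T : Fin n → Bool) : Set where
    field
      I           : Fin n → Bool
      independent : Independent I
      T⊆I         : ∀ u → T u ≡ true → I u ≡ true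
      forbidden⊆S : ∀ u → I u ≡ true → forbidden u ≡ true → S u ≡ true
      dominating  : ∀ v → v ∈ vs → forbidden v ≡ false → I v ≡ true ⊎ HasNeighbourIn I v

  extension-∷ : ∀ {forbidden S vs T T′ v} (ext : Extension forbidden S vs T′) →
                (∀ u → T u ≡ true → T′ u ≡ true) →
                (forbidden v ≡ false →
                   Extension.I ext v ≡ true ⊎ HasNeighbourIn (Extension.I ext) v) →
                Extension forbidden S (v ∷ vs) T
  extension-∷ ext T⊆T′ dominating-v = record
    { I           = I
    ; independent = independent
    ; T⊆I         = λ u Tu → T⊆I u (T⊆T′ u Tu)
    ; forbidden⊆S = forbidden⊆S
    ; dominating  = λ { _ (here refl) → dominating-v ; w (there w∈vs) → dominating w w∈vs }
    }
    where open Extension ext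

  extend : ∀ forbidden S vs T → Independent T →
           (∀ u → T u ≡ true → forbidden u ≡ true → S u ≡ true) → Extension forbidden S vs T
  extend forbidden S [] T indT T⊆S = record
    { I = T ; independent = indT ; T⊆I = λ _ Tu → Tu ; forbidden⊆S = T⊆S ; dominating = λ _ () }
  extend forbidden S (v ∷ vs) T indT T⊆S with forbidden v in fv | hasNeighbourIn? T v
  ... | true  | _ = extension-∷ (extend forbidden S vs T indT T⊆S) (λ _ Tu → Tu)
                      (λ fv′ → case trans (sym fv) fv′ of λ ())
  ... | false | yes (t , Tt , vt) =
    extension-∷ ext (λ _ Tu → Tu) (λ _ → inj₂ (t , Extension.T⊆I ext t Tt , vt))
    where ext = extend forbidden S vs T indT T⊆S
  ... | false | no ¬nbr =
    extension-∷ ext (insert-⊇ v T) (λ _ → inj₁ (Extension.T⊆I ext v (insert-here v T)))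
    where
    indT′ : Independent (insert v T)
    indT′ u w Tu Tw e with insert-inv v T u Tu | insert-inv v T w Tw
    ... | inj₁ refl | inj₁ refl = edge-irrefl e
    ... | inj₁ refl | inj₂ Tw′  = ¬nbr (w , Tw′ , e)
    ... | inj₂ Tu′  | inj₁ refl = ¬nbr (u , Tu′ , edge-sym e)
    ... | inj₂ Tu′  | inj₂ Tw′  = indT u w Tu′ Tw′ e
    T′⊆S : ∀ u → insert v T u ≡ true → forbidden u ≡ true → S u ≡ true
    T′⊆S u Tu fu with insert-inv v T u Tu
    ... | inj₁ refl with () ← trans (sym fu) fv
    ... | inj₂ Tu′ = T⊆S u Tu′ fu
    ext = extend forbidden S vs (insert v T) indT′ T′⊆S

  maximal-extension : ∀ forbidden S → Independent S → Extension forbidden S (allFin n) S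
  maximal-extension forbidden S indS = extend forbidden S (allFin n) S indS (λ _ Su _ → Su)

  maximal-extension-dominates : ∀ {forbidden S T} (ext : Extension forbidden S (allFin n) T) →
                                ∀ v → forbidden v ≡ false → Extension.I ext v ≡ false →
                                HasNeighbourIn (Extension.I ext) v
  maximal-extension-dominates ext v fv Iv with Extension.dominating ext v (∈-allFin v) fv
  ... | inj₁ Iv′ = case trans (sym Iv) Iv′ of λ ()
  ... | inj₂ nbr = nbr

  Disjoint : (Fin n → Bool) → (Fin n → Bool) → Set
  Disjoint S T = ∀ u → S u ≡ true → T u ≡ true → ⊥

  ridf-from-dominating-pair :
    ∀ I₁ I₂ → Independent I₁ → Independent I₂ → Disjoint I₁ I₂ →
    (∀ v → I₁ v ≡ false → I₂ v ≡ false → HasNeighbourIn I₁ v × HasNeighbourIn I₂ v) →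
    Is2RiDF G (λ u → colour (I₁ u) (I₂ u))
  ridf-from-dominating-pair I₁ I₂ ind₁ ind₂ disj dom = valid
    where
    f : Fin n → Fin 3
    f u = colour (I₁ u) (I₂ u)
    f≡1 : ∀ t → I₁ t ≡ true → f t ≡ 1F
    f≡1 t I₁t rewrite I₁t = refl
    f≡2 : ∀ t → I₂ t ≡ true → f t ≡ 2F
    f≡2 t I₂t rewrite I₂t | ¬true⇒false (λ I₁t → disj t I₁t I₂t) = refl
    dom₀ : ∀ v → f v ≡ 0F → HasNeighbourIn I₁ v × HasNeighbourIn I₂ v
    dom₀ v fv = let (I₁v , I₂v) = colour≡0⇒neither _ _ fv in dom v I₁v I₂v
    valid : Is2RiDF G f
    valid 0F ne = contradiction refl ne
    valid 1F _ =
      (λ u v e fu fv → ind₁ u v (colour≡1⇒first _ _ fu) (colour≡1⇒first _ _ fv) e) ,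
      λ v fv → let (t , I₁t , vt) = proj₁ (dom₀ v fv) in t , vt , f≡1 t I₁t
    valid 2F _ =
      (λ u v e fu fv → ind₂ u v (colour≡2⇒second _ _ fu) (colour≡2⇒second _ _ fv) e) ,
      λ v fv → let (t , I₂t , vt) = proj₂ (dom₀ v fv) in t , vt , f≡2 t I₂t

  -- I₁ extends S₁ avoiding S₂ ∪ W, then I₂ extends S₂ avoiding I₁ ∪ W; every vertex of W
  -- stays uncoloured because it already has a neighbour in S₁ ⊆ I₁ and in S₂ ⊆ I₂.
  ridf-vanishing-on :
    ∀ S₁ S₂ W → Independent S₁ → Independent S₂ → Disjoint S₁ S₂ →
    (∀ w → W w ≡ true → HasNeighbourIn S₁ w × HasNeighbourIn S₂ w) →
    Σ (Fin n → Fin 3) λ f → Is2RiDF G f × (∀ w → W w ≡ true → f w ≡ 0F)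
  ridf-vanishing-on S₁ S₂ W ind₁ ind₂ disj domW =
    (λ u → colour (I₁ u) (I₂ u)) ,
    ridf-from-dominating-pair I₁ I₂ (independent E₁) (independent E₂) I₁∩I₂ dom ,
    vanish
    where
    open Extension
    E₁ = maximal-extension (λ u → S₂ u ∨ W u) S₁ ind₁
    I₁ = I E₁
    E₂ = maximal-extension (λ u → I₁ u ∨ W u) S₂ ind₂
    I₂ = I E₂
    I₁∩S₂ : Disjoint I₁ S₂
    I₁∩S₂ u I₁u S₂u = disj u (forbidden⊆S E₁ u I₁u (∨-introˡ S₂u)) S₂u
    I₁∩W : Disjoint I₁ W
    I₁∩W u I₁u Wu = let (t , S₁t , ut) = proj₁ (domW u Wu)
                    in ind₁ u t (forbidden⊆S E₁ u I₁u (∨-introʳ (S₂ u) Wu)) S₁t ut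
    I₂∩W : Disjoint I₂ W
    I₂∩W u I₂u Wu = let (t , S₂t , ut) = proj₂ (domW u Wu)
                    in ind₂ u t (forbidden⊆S E₂ u I₂u (∨-introʳ (I₁ u) Wu)) S₂t ut
    I₁∩I₂ : Disjoint I₁ I₂
    I₁∩I₂ u I₁u I₂u = I₁∩S₂ u I₁u (forbidden⊆S E₂ u I₂u (∨-introˡ I₁u))
    vanish : ∀ w → W w ≡ true → colour (I₁ w) (I₂ w) ≡ 0F
    vanish w Ww rewrite ¬true⇒false (λ I₁w → I₁∩W w I₁w Ww) | ¬true⇒false (λ I₂w → I₂∩W w I₂w Ww) = refl
    dom : ∀ v → I₁ v ≡ false → I₂ v ≡ false → HasNeighbourIn I₁ v × HasNeighbourIn I₂ v
    dom v I₁v I₂v with W v in Wv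
    ... | true = let ((t₁ , S₁t₁ , vt₁) , (t₂ , S₂t₂ , vt₂)) = domW v Wv
                 in (t₁ , T⊆I E₁ t₁ S₁t₁ , vt₁) , (t₂ , T⊆I E₂ t₂ S₂t₂ , vt₂)
    ... | false =
      maximal-extension-dominates E₁ v (∨-false S₂v Wv) I₁v ,
      maximal-extension-dominates E₂ v (∨-false I₁v Wv) I₂v
      where
      S₂v : S₂ v ≡ false
      S₂v = ¬true⇒false λ S₂v → case trans (sym I₂v) (T⊆I E₂ v S₂v) of λ ()

module _ {n : ℕ} (G : Graph n) where
  open Adjacency G

  -- The trace of a 2RiDF with the two zeros x and y: aᵢ and bᵢ are neighbours
  -- of the i-th zero carrying the values 1 and 2.
  record Certificate : Set where
    constructor certificate
    field
      x y a₁ b₁ a₂ b₂ : Fin n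
      x≢y : x ≢ y
      xa₁ : Edge x a₁
      xb₁ : Edge x b₁
      ya₂ : Edge y a₂
      yb₂ : Edge y b₂
      a₁a₂ : IndependentPair a₁ a₂
      b₁b₂ : IndependentPair b₁ b₂
      a₁≢b₁ : a₁ ≢ b₁
      a₁≢b₂ : a₁ ≢ b₂
      a₂≢b₁ : a₂ ≢ b₁
      a₂≢b₂ : a₂ ≢ b₂

  certificate-sharing-a : ∀ {x y a b₁ b₂} → x ≢ y → Edge x a → Edge x b₁ → Edge y a → Edge y b₂ →
                          IndependentPair b₁ b₂ → a ≢ b₁ → a ≢ b₂ → Certificate
  certificate-sharing-a x≢y xa xb₁ ya yb₂ b₁b₂ a≢b₁ a≢b₂ =
    certificate _ _ _ _ _ _ x≢y xa xb₁ ya yb₂ (inj₁ refl) b₁b₂ a≢b₁ a≢b₂ a≢b₁ a≢b₂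

  certificate-swap : Certificate → Certificate
  certificate-swap (certificate x y a₁ b₁ a₂ b₂ x≢y xa₁ xb₁ ya₂ yb₂ a₁a₂ b₁b₂ a₁≢b₁ a₁≢b₂ a₂≢b₁ a₂≢b₂) =
    certificate y x a₂ b₂ a₁ b₁ (x≢y ∘ sym) ya₂ yb₂ xa₁ xb₁ (swap-pair a₁a₂) (swap-pair b₁b₂)
      a₂≢b₂ a₂≢b₁ a₁≢b₂ a₁≢b₁
    where
    swap-pair : ∀ {u v} → IndependentPair u v → IndependentPair v u
    swap-pair (inj₁ u≡v)  = inj₁ (sym u≡v)
    swap-pair (inj₂ ¬uv) = inj₂ (¬uv ∘ edge-sym)

  ¬common-neighbour-pair : ¬ Certificate → ∀ {x y p q} → x ≢ y → p ≢ q →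
                           Edge x p → Edge x q → Edge y p → Edge y q → ⊥
  ¬common-neighbour-pair ¬cert x≢y p≢q xp xq yp yq =
    ¬cert (certificate-sharing-a x≢y xp xq yp yq (inj₁ refl) p≢q p≢q)

  pair : Fin n → Fin n → Fin n → Bool
  pair a b u = does (u ≟ a) ∨ does (u ≟ b)

  pair-inv : ∀ a b u → pair a b u ≡ true → u ≡ a ⊎ u ≡ b
  pair-inv a b u h with u ≟ a | u ≟ b
  ... | yes u≡a | _       = inj₁ u≡a
  ... | no  _   | yes u≡b = inj₂ u≡b

  pair-left : ∀ a b → pair a b a ≡ true
  pair-left a b rewrite dec-true (a ≟ a) refl = refl

  pair-right : ∀ a b → pair a b b ≡ true
  pair-right a b rewrite dec-true (b ≟ b) refl = ∨-zeroʳ (does (b ≟ a))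

  pair-independent : ∀ {a b} → IndependentPair a b → Independent G (pair a b)
  pair-independent {a} {b} ab u v Pu Pv e with pair-inv a b u Pu | pair-inv a b v Pv | ab
  ... | inj₁ refl | inj₁ refl | _         = edge-irrefl e
  ... | inj₂ refl | inj₂ refl | _         = edge-irrefl e
  ... | inj₁ refl | inj₂ refl | inj₁ refl = edge-irrefl e
  ... | inj₁ refl | inj₂ refl | inj₂ ¬ab  = ¬ab e
  ... | inj₂ refl | inj₁ refl | inj₁ refl = edge-irrefl e
  ... | inj₂ refl | inj₁ refl | inj₂ ¬ab  = ¬ab (edge-sym e)

  ridf-vanishing-at : ∀ {x y a₁ b₁ a₂ b₂} → Edge x a₁ → Edge x b₁ → Edge y a₂ → Edge y b₂ →
                      IndependentPair a₁ a₂ → IndependentPair b₁ b₂ →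
                      a₁ ≢ b₁ → a₁ ≢ b₂ → a₂ ≢ b₁ → a₂ ≢ b₂ →
                      Σ (Fin n → Fin 3) λ f → Is2RiDF G f × f x ≡ 0F × f y ≡ 0F
  ridf-vanishing-at {x} {y} {a₁} {b₁} {a₂} {b₂} xa₁ xb₁ ya₂ yb₂ a₁a₂ b₁b₂ a₁≢b₁ a₁≢b₂ a₂≢b₁ a₂≢b₂
    with ridf-vanishing-on G (pair a₁ a₂) (pair b₁ b₂) (pair x y)
           (pair-independent a₁a₂) (pair-independent b₁b₂) disjoint dominated
    where
    disjoint : Disjoint G (pair a₁ a₂) (pair b₁ b₂)
    disjoint u A B with pair-inv a₁ a₂ u A | pair-inv b₁ b₂ u B
    ... | inj₁ refl | inj₁ refl = a₁≢b₁ refl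
    ... | inj₁ refl | inj₂ refl = a₁≢b₂ refl
    ... | inj₂ refl | inj₁ refl = a₂≢b₁ refl
    ... | inj₂ refl | inj₂ refl = a₂≢b₂ refl
    dominated : ∀ w → pair x y w ≡ true →
                HasNeighbourIn G (pair a₁ a₂) w × HasNeighbourIn G (pair b₁ b₂) w
    dominated w h with pair-inv x y w h
    ... | inj₁ refl = (a₁ , pair-left a₁ a₂ , xa₁) , (b₁ , pair-left b₁ b₂ , xb₁)
    ... | inj₂ refl = (a₂ , pair-right a₁ a₂ , ya₂) , (b₂ , pair-right b₁ b₂ , yb₂)
  ... | f , valid , vanish = f , valid , vanish x (pair-left x y) , vanish y (pair-right x y)

  certificate⇒ridf : Certificate → Σ (Fin n → Fin 3) λ f → Is2RiDF G f × 2 + weight f ≤ n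
  certificate⇒ridf (certificate _ _ _ _ _ _ x≢y xa₁ xb₁ ya₂ yb₂ a₁a₂ b₁b₂ a₁≢b₁ a₁≢b₂ a₂≢b₁ a₂≢b₂)
    with ridf-vanishing-at xa₁ xb₁ ya₂ yb₂ a₁a₂ b₁b₂ a₁≢b₁ a₁≢b₂ a₂≢b₁ a₂≢b₂
  ... | f , valid , fx , fy = f , valid , two-zeros⇒2+weight≤n f x≢y fx fy

  degree≥2⇒ridf : Degree≥2 → Σ (Fin n → Fin 3) λ f → Is2RiDF G f × weight f < n
  degree≥2⇒ridf (_ , _ , _ , p≢q , xp , xq)
    with ridf-vanishing-at xp xq xp xq (inj₁ refl) (inj₁ refl) p≢q p≢q p≢q p≢q
  ... | f , valid , fx , _ = f , valid , zero⇒weight<n f fx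

  ridf⇒certificate : ∀ {f} → Is2RiDF G f → ∀ {x y} → x ≢ y → f x ≡ 0F → f y ≡ 0F → Certificate
  ridf⇒certificate {f} valid {x} {y} x≢y fx fy
    with proj₂ (valid 1F (λ ())) x fx | proj₂ (valid 1F (λ ())) y fy
       | proj₂ (valid 2F (λ ())) x fx | proj₂ (valid 2F (λ ())) y fy
  ... | a₁ , xa₁ , fa₁ | a₂ , ya₂ , fa₂ | b₁ , xb₁ , fb₁ | b₂ , yb₂ , fb₂ =
    certificate x y a₁ b₁ a₂ b₂ x≢y xa₁ xb₁ ya₂ yb₂
      (same-value (λ ()) fa₁ fa₂) (same-value (λ ()) fb₁ fb₂)
      (values-1-2 fa₁ fb₁) (values-1-2 fa₁ fb₂) (values-1-2 fa₂ fb₁) (values-1-2 fa₂ fb₂)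
    where
    same-value : ∀ {i u v} → i ≢ 0F → f u ≡ i → f v ≡ i → IndependentPair u v
    same-value {i} {u} {v} i≢0 fu fv with u ≟ v
    ... | yes u≡v = inj₁ u≡v
    ... | no  _   = inj₂ (λ uv → proj₁ (valid i i≢0) u v uv fu fv)
    values-1-2 : ∀ {u v} → f u ≡ 1F → f v ≡ 2F → u ≢ v
    values-1-2 fu fv refl with () ← trans (sym fu) fv

  zero⇒degree≥2 : ∀ {f} → Is2RiDF G f → ∀ {x} → f x ≡ 0F → Degree≥2
  zero⇒degree≥2 {f} valid {x} fx with proj₂ (valid 1F (λ ())) x fx | proj₂ (valid 2F (λ ())) x fx
  ... | a , xa , fa | b , xb , fb = x , a , b , a≢b , xa , xb
    where
    a≢b : a ≢ b
    a≢b refl with () ← trans (sym fa) fb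

γri2≡pred⇔ : ∀ {m} (G : Graph (suc m)) → γri2≡ G m ⇔ (Adjacency.Degree≥2 G × ¬ Certificate G)
γri2≡pred⇔ {m} G = mk⇔ forward backward
  where
  forward : γri2≡ G m → Adjacency.Degree≥2 G × ¬ Certificate G
  forward ((f , valid , weight≡m) , minimal) = degree≥2 , ¬cert
    where
    degree≥2 : Adjacency.Degree≥2 G
    degree≥2 with any? (λ x → f x ≟ 0F)
    ... | yes (x , fx) = zero⇒degree≥2 G valid fx
    ... | no  ¬zero    = ⊥-elim (1+n≰n (≤-reflexive (trans (sym weight≡1+m) weight≡m)))
      where weight≡1+m = no-zero⇒weight≡n f λ x fx → ¬zero (x , fx)
    ¬cert : ¬ Certificate G
    ¬cert c with certificate⇒ridf G c
    ... | g , valid-g , 2+wg≤1+m = 1+n≰n (≤-trans (s≤s (minimal g valid-g)) (s≤s⁻¹ 2+wg≤1+m))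
  backward : Adjacency.Degree≥2 G × ¬ Certificate G → γri2≡ G m
  backward (degree≥2 , ¬cert) with degree≥2⇒ridf G degree≥2
  ... | f , valid , wf<1+m = (f , valid , ≤-antisym (s≤s⁻¹ wf<1+m) (minimal f valid)) , minimal
    where
    minimal : ∀ g → Is2RiDF G g → m ≤ weight g
    minimal g valid-g = s≤s⁻¹ (one-zero⇒n≤1+weight g at-most-one-zero)
      where
      at-most-one-zero : ∀ x y → g x ≡ 0F → g y ≡ 0F → x ≡ y
      at-most-one-zero x y gx gy with x ≟ y
      ... | yes x≡y = x≡y
      ... | no  x≢y = contradiction (ridf⇒certificate G valid-g x≢y gx gy) ¬cert

module _ {n m : ℕ} {G : Graph n} {H : Graph m} {v : Fin n} (iso : ComponentIso G v H) where
  private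
    module G = Adjacency G
    module H = Adjacency H
    φ = proj₁ iso
    φ-injective = proj₁ (proj₂ iso)
    φ-onto = proj₁ (proj₂ (proj₂ (proj₂ iso)))
    φ-adj = proj₂ (proj₂ (proj₂ (proj₂ iso)))

  edge-reflect : ∀ {i j} → G.Edge (φ i) (φ j) → H.Edge i j
  edge-reflect {i} {j} e = trans (φ-adj i j) e

  edge-preserve : ∀ {i j} → H.Edge i j → G.Edge (φ i) (φ j)
  edge-preserve {i} {j} e = trans (sym (φ-adj i j)) e

  component-degree≥2 : H.Degree≥2 → G.Degree≥2
  component-degree≥2 (x , p , q , p≢q , xp , xq) =
    φ x , φ p , φ q , p≢q ∘ φ-injective , edge-preserve xp , edge-preserve xq

  component-degree≥2⁻¹ : ∀ {w p q} → Reach G v w → p ≢ q → G.Edge w p → G.Edge w q → H.Degree≥2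
  component-degree≥2⁻¹ vw p≢q wp wq
    with φ-onto _ vw | φ-onto _ (step vw wp) | φ-onto _ (step vw wq)
  ... | w′ , refl | p′ , refl | q′ , refl =
    w′ , p′ , q′ , p≢q ∘ cong φ , edge-reflect wp , edge-reflect wq

  component-certificate : (c : Certificate G) →
                          Reach G v (Certificate.x c) → Reach G v (Certificate.y c) → Certificate H
  component-certificate c vx vy
    with φ-onto x vx | φ-onto y vy | φ-onto a₁ (step vx xa₁) | φ-onto b₁ (step vx xb₁)
       | φ-onto a₂ (step vy ya₂) | φ-onto b₂ (step vy yb₂)
    where open Certificate c
  ... | x′ , refl | y′ , refl | a₁′ , refl | b₁′ , refl | a₂′ , refl | b₂′ , refl =
    certificate x′ y′ a₁′ b₁′ a₂′ b₂′ (x≢y ∘ cong φ) (edge-reflect xa₁) (edge-reflect xb₁)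
      (edge-reflect ya₂) (edge-reflect yb₂) (pair-reflect a₁a₂) (pair-reflect b₁b₂)
      (a₁≢b₁ ∘ cong φ) (a₁≢b₂ ∘ cong φ) (a₂≢b₁ ∘ cong φ) (a₂≢b₂ ∘ cong φ)
    where
    open Certificate c
    pair-reflect : ∀ {i j} → G.IndependentPair (φ i) (φ j) → H.IndependentPair i j
    pair-reflect (inj₁ φi≡φj) = inj₁ (φ-injective φi≡φj)
    pair-reflect (inj₂ ¬e)    = inj₂ (¬e ∘ edge-preserve)

module _ {n : ℕ} (G : Graph n) where
  open Adjacency G

  CoveredBy : Fin n → Fin n → Set
  CoveredBy x y = Σ (Fin n) λ t → ∀ u → Edge y u → u ≡ x ⊎ u ≡ t

  -- The neighbours a₂ ≢ b₂ of y would have to be x and t, but x ∉ {a₂, b₂} since it is adjacent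
  -- to a₁ and to b₁.
  certificate-zeros-uncovered : (c : Certificate G) → ¬ CoveredBy (Certificate.x c) (Certificate.y c)
  certificate-zeros-uncovered
    (certificate x y a₁ b₁ a₂ b₂ _ xa₁ xb₁ ya₂ yb₂ a₁a₂ b₁b₂ _ _ _ a₂≢b₂) (t , N[y])
    with N[y] a₂ ya₂ | N[y] b₂ yb₂
  ... | inj₁ refl | _         = independent-pair⇒≢ a₁a₂ xa₁ refl
  ... | _         | inj₁ refl = independent-pair⇒≢ b₁b₂ xb₁ refl
  ... | inj₂ refl | inj₂ refl = a₂≢b₂ refl

  covered⇒¬certificate : (∀ x y → x ≢ y → CoveredBy x y ⊎ CoveredBy y x) → ¬ Certificate G
  covered⇒¬certificate covered c with covered _ _ (Certificate.x≢y c)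
  ... | inj₁ y-covered = certificate-zeros-uncovered c y-covered
  ... | inj₂ x-covered = certificate-zeros-uncovered (certificate-swap G c) x-covered

  neighbours⊆⇒covered : ∀ {x y s t} → (∀ u → Edge y u → u ≡ s ⊎ u ≡ t) → x ≡ s ⊎ x ≡ t →
                        CoveredBy x y
  neighbours⊆⇒covered {t = t} N[y] (inj₁ refl) = t , N[y]
  neighbours⊆⇒covered {s = s} N[y] (inj₂ refl) = s , λ u yu → swap (N[y] u yu)

  degree≤1⇒covered : ∀ {x y t} → (∀ u → Edge y u → u ≡ t) → CoveredBy x y
  degree≤1⇒covered {t = t} N[y] = t , λ u yu → inj₂ (N[y] u yu)

star-leaf : ∀ {m} j u → staradj {m} (suc j) u ≡ true → u ≡ zero
star-leaf j zero _ = refl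

star-covered : ∀ m (x y : Fin (suc m)) → x ≢ y → CoveredBy (Star m) x y ⊎ CoveredBy (Star m) y x
star-covered m x       (suc j) _   = inj₁ (degree≤1⇒covered (Star m) (star-leaf j))
star-covered m (suc i) zero    _   = inj₂ (degree≤1⇒covered (Star m) (star-leaf i))
star-covered m zero    zero    x≢y = contradiction refl x≢y

¬certificate-Star : ∀ m → ¬ Certificate (Star m)
¬certificate-Star m = covered⇒¬certificate (Star m) (star-covered m)

degree≥2-Star : ∀ k → Adjacency.Degree≥2 (Star (2 + k))
degree≥2-Star k = 0F , 1F , 2F , (λ ()) , refl , refl

module _ {k : ℕ} where

  starPlus-leaf : ∀ j u → starPlusAdj {k} (suc (suc (suc j))) u ≡ true → u ≡ 0F
  starPlus-leaf j 0F _ = refl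

  starPlus-neighbours₁ : ∀ u → starPlusAdj {k} 1F u ≡ true → u ≡ 0F ⊎ u ≡ 2F
  starPlus-neighbours₁ 0F _ = inj₁ refl
  starPlus-neighbours₁ 2F _ = inj₂ refl

  starPlus-neighbours₂ : ∀ u → starPlusAdj {k} 2F u ≡ true → u ≡ 0F ⊎ u ≡ 1F
  starPlus-neighbours₂ 0F _ = inj₁ refl
  starPlus-neighbours₂ 1F _ = inj₂ refl

  private
    covered-at-1 : ∀ {x} → x ≡ 0F ⊎ x ≡ 2F → CoveredBy (StarPlus k) x 1F
    covered-at-1 = neighbours⊆⇒covered (StarPlus k) starPlus-neighbours₁

    covered-at-2 : ∀ {x} → x ≡ 0F ⊎ x ≡ 1F → CoveredBy (StarPlus k) x 2F
    covered-at-2 = neighbours⊆⇒covered (StarPlus k) starPlus-neighbours₂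

  starPlus-covered : ∀ x y → x ≢ y → CoveredBy (StarPlus k) x y ⊎ CoveredBy (StarPlus k) y x
  starPlus-covered x (suc (suc (suc j))) _ = inj₁ (degree≤1⇒covered (StarPlus k) (starPlus-leaf j))
  starPlus-covered (suc (suc (suc i))) y _ = inj₂ (degree≤1⇒covered (StarPlus k) (starPlus-leaf i))
  starPlus-covered 0F 1F _   = inj₁ (covered-at-1 (inj₁ refl))
  starPlus-covered 2F 1F _   = inj₁ (covered-at-1 (inj₂ refl))
  starPlus-covered 0F 2F _   = inj₁ (covered-at-2 (inj₁ refl))
  starPlus-covered 1F 2F _   = inj₁ (covered-at-2 (inj₂ refl))
  starPlus-covered 1F 0F _   = inj₂ (covered-at-1 (inj₁ refl))
  starPlus-covered 2F 0F _   = inj₂ (covered-at-2 (inj₁ refl))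
  starPlus-covered 0F 0F x≢y = contradiction refl x≢y
  starPlus-covered 1F 1F x≢y = contradiction refl x≢y
  starPlus-covered 2F 2F x≢y = contradiction refl x≢y

¬certificate-StarPlus : ∀ k → ¬ Certificate (StarPlus k)
¬certificate-StarPlus k = covered⇒¬certificate (StarPlus k) starPlus-covered

degree≥2-StarPlus : ∀ k → Adjacency.Degree≥2 (StarPlus k)
degree≥2-StarPlus k = 0F , 1F , 2F , (λ ()) , refl , refl

module _ {k : ℕ} where
  private
    N = 2 + k
    DS = DoubleStar (1 + k) 1
    Side = Fin N ⊎ Fin 2
    u₀ v₀ v₁ : Side
    u₀ = inj₁ zero
    v₀ = inj₂ zero
    v₁ = inj₂ (suc zero)

  doubleStar-leaf₁ : ∀ j r → dsAdj {1 + k} {1} (inj₁ (suc j)) r ≡ true → r ≡ u₀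
  doubleStar-leaf₁ j (inj₁ zero) _ = refl

  doubleStar-leaf₂ : ∀ j r → dsAdj {1 + k} {1} (inj₂ (suc j)) r ≡ true → r ≡ v₀
  doubleStar-leaf₂ j (inj₂ zero) _ = refl

  doubleStar-neighbours-v₀ : ∀ r → dsAdj {1 + k} {1} v₀ r ≡ true → r ≡ u₀ ⊎ r ≡ v₁
  doubleStar-neighbours-v₀ (inj₁ zero)       _ = inj₁ refl
  doubleStar-neighbours-v₀ (inj₂ (suc zero)) _ = inj₂ refl

  private
    vertex : ∀ x {s} → splitAt N x ≡ s → x ≡ join N 2 s
    vertex x refl = sym (join-splitAt N 2 x)

    side-edge : ∀ y u {s} → splitAt N y ≡ s → Adjacency.Edge DS y u → dsAdj s (splitAt N u) ≡ true
    side-edge y u refl e = e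

    leaf : ∀ x y {s} {t : Side} → splitAt N y ≡ s → (∀ r → dsAdj s r ≡ true → r ≡ t) → CoveredBy DS x y
    leaf x y ys N[s] = degree≤1⇒covered DS {x} {y} λ u e → vertex u (N[s] (splitAt N u) (side-edge y u ys e))

    centre-v₀ : ∀ x y → splitAt N y ≡ v₀ → splitAt N x ≡ u₀ → CoveredBy DS x y
    centre-v₀ x y ys xs = neighbours⊆⇒covered DS {x} {y} N[y] (inj₁ (vertex x xs))
      where
      N[y] : ∀ u → Adjacency.Edge DS y u → u ≡ join N 2 u₀ ⊎ u ≡ join N 2 v₁
      N[y] u e with doubleStar-neighbours-v₀ (splitAt N u) (side-edge y u ys e)
      ... | inj₁ us = inj₁ (vertex u us)
      ... | inj₂ us = inj₂ (vertex u us)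

  doubleStar-covered : ∀ x y → x ≢ y → CoveredBy DS x y ⊎ CoveredBy DS y x
  doubleStar-covered x y x≢y = by-sides (splitAt N x) (splitAt N y) refl refl
    where
    same-side : ∀ {s} → splitAt N x ≡ s → splitAt N y ≡ s → ⊥
    same-side xs ys = x≢y (trans (vertex x xs) (sym (vertex y ys)))
    by-sides : ∀ s t → splitAt N x ≡ s → splitAt N y ≡ t → CoveredBy DS x y ⊎ CoveredBy DS y x
    by-sides _              (inj₁ (suc j)) _  ys = inj₁ (leaf x y ys (doubleStar-leaf₁ j))
    by-sides _              (inj₂ (suc j)) _  ys = inj₁ (leaf x y ys (doubleStar-leaf₂ j))
    by-sides (inj₁ (suc i)) _              xs _  = inj₂ (leaf y x xs (doubleStar-leaf₁ i))
    by-sides (inj₂ (suc i)) _              xs _  = inj₂ (leaf y x xs (doubleStar-leaf₂ i))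
    by-sides (inj₁ zero)    (inj₁ zero)    xs ys = ⊥-elim (same-side xs ys)
    by-sides (inj₂ zero)    (inj₂ zero)    xs ys = ⊥-elim (same-side xs ys)
    by-sides (inj₁ zero)    (inj₂ zero)    xs ys = inj₁ (centre-v₀ x y ys xs)
    by-sides (inj₂ zero)    (inj₁ zero)    xs ys = inj₂ (centre-v₀ y x xs ys)

¬certificate-DoubleStar : ∀ k → ¬ Certificate (DoubleStar (1 + k) 1)
¬certificate-DoubleStar k = covered⇒¬certificate (DoubleStar (1 + k) 1) doubleStar-covered

degree≥2-DoubleStar : ∀ k → Adjacency.Degree≥2 (DoubleStar (1 + k) 1)
degree≥2-DoubleStar k = 0F , 1F , (2 + k) ↑ʳ 0F , (λ ()) , refl , u₀v₀
  where
  u₀v₀ : dsAdj {1 + k} {1} (inj₁ 0F) (splitAt (2 + k) ((2 + k) ↑ʳ 0F)) ≡ true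
  u₀v₀ rewrite splitAt-↑ʳ (2 + k) 2 0F = refl

module _ {n : ℕ} (G : Graph n) where
  open Adjacency G

  private
    CertificateAt : (x y a₁ b₁ a₂ b₂ : Fin n) → Set
    CertificateAt x y a₁ b₁ a₂ b₂ =
      x ≢ y × Edge x a₁ × Edge x b₁ × Edge y a₂ × Edge y b₂ ×
      IndependentPair a₁ a₂ × IndependentPair b₁ b₂ × a₁ ≢ b₁ × a₁ ≢ b₂ × a₂ ≢ b₁ × a₂ ≢ b₂

    independentPair? : ∀ a b → Dec (IndependentPair a b)
    independentPair? a b = (a ≟ b) ⊎-dec ¬? (edge? a b)

    certificateAt? : ∀ x y a₁ b₁ a₂ b₂ → Dec (CertificateAt x y a₁ b₁ a₂ b₂)
    certificateAt? x y a₁ b₁ a₂ b₂ =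
      ¬? (x ≟ y) ×-dec edge? x a₁ ×-dec edge? x b₁ ×-dec edge? y a₂ ×-dec edge? y b₂ ×-dec
      independentPair? a₁ a₂ ×-dec independentPair? b₁ b₂ ×-dec
      ¬? (a₁ ≟ b₁) ×-dec ¬? (a₁ ≟ b₂) ×-dec ¬? (a₂ ≟ b₁) ×-dec ¬? (a₂ ≟ b₂)

  certificate? : Dec (Certificate G)
  certificate? = map′
    (λ (x , y , a₁ , b₁ , a₂ , b₂ , p) → let (p₁ , p₂ , p₃ , p₄ , p₅ , p₆ , p₇ , p₈ , p₉ , p₁₀ , p₁₁) = p
       in certificate x y a₁ b₁ a₂ b₂ p₁ p₂ p₃ p₄ p₅ p₆ p₇ p₈ p₉ p₁₀ p₁₁)
    (λ (certificate x y a₁ b₁ a₂ b₂ p₁ p₂ p₃ p₄ p₅ p₆ p₇ p₈ p₉ p₁₀ p₁₁) →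
       x , y , a₁ , b₁ , a₂ , b₂ , p₁ , p₂ , p₃ , p₄ , p₅ , p₆ , p₇ , p₈ , p₉ , p₁₀ , p₁₁)
    (any? λ x → any? λ y → any? λ a₁ → any? λ b₁ → any? λ a₂ → any? λ b₂ → certificateAt? x y a₁ b₁ a₂ b₂)

¬certificate-C₅ : ¬ Certificate C₅
¬certificate-C₅ = from-no (certificate? C₅)

degree≥2-C₅ : Adjacency.Degree≥2 C₅
degree≥2-C₅ = 0F , 1F , 4F , (λ ()) , refl , refl

¬degree≥2-K₁ : ¬ Adjacency.Degree≥2 K₁
¬degree≥2-K₁ (_ , zero , zero , p≢q , _) = p≢q refl

¬degree≥2-K₂ : ¬ Adjacency.Degree≥2 K₂
¬degree≥2-K₂ (zero     , suc zero , suc zero , p≢q , _) = p≢q refl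
¬degree≥2-K₂ (suc zero , zero     , zero     , p≢q , _) = p≢q refl

module _ {n : ℕ} (G : Graph n) where
  open Adjacency G

  special-¬certificate : ∀ {v} → SpecialComponent G v → (c : Certificate G) →
                         Reach G v (Certificate.x c) → Reach G v (Certificate.y c) → ⊥
  special-¬certificate (inj₁ (k , iso))               c vx vy =
    ¬certificate-Star (2 + k) (component-certificate iso c vx vy)
  special-¬certificate (inj₂ (inj₁ (k , iso)))        c vx vy =
    ¬certificate-StarPlus k (component-certificate iso c vx vy)
  special-¬certificate (inj₂ (inj₂ (inj₁ (k , iso)))) c vx vy =
    ¬certificate-DoubleStar k (component-certificate iso c vx vy)
  special-¬certificate (inj₂ (inj₂ (inj₂ iso)))       c vx vy =
    ¬certificate-C₅ (component-certificate iso c vx vy)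

  special-degree≥2 : ∀ {v} → SpecialComponent G v → Degree≥2
  special-degree≥2 (inj₁ (k , iso)) =
    component-degree≥2 {H = Star (2 + k)} iso (degree≥2-Star k)
  special-degree≥2 (inj₂ (inj₁ (k , iso))) =
    component-degree≥2 {H = StarPlus k} iso (degree≥2-StarPlus k)
  special-degree≥2 (inj₂ (inj₂ (inj₁ (k , iso)))) =
    component-degree≥2 {H = DoubleStar (1 + k) 1} iso (degree≥2-DoubleStar k)
  special-degree≥2 (inj₂ (inj₂ (inj₂ iso))) =
    component-degree≥2 {H = C₅} iso degree≥2-C₅

  small-component-degree<2 : ∀ {w p q} → ComponentIso G w K₁ ⊎ ComponentIso G w K₂ →
                             p ≢ q → Edge w p → Edge w q → ⊥
  small-component-degree<2 (inj₁ iso) p≢q wp wq =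
    ¬degree≥2-K₁ (component-degree≥2⁻¹ {H = K₁} iso here p≢q wp wq)
  small-component-degree<2 (inj₂ iso) p≢q wp wq =
    ¬degree≥2-K₂ (component-degree≥2⁻¹ {H = K₂} iso here p≢q wp wq)

  characterisation⇒degree≥2 : Characterisation G → Degree≥2
  characterisation⇒degree≥2 (_ , special , _) = special-degree≥2 special

  -- Both zeros of a certificate have two neighbours, so neither lies in a K₁ or K₂ component.
  characterisation⇒¬certificate : Characterisation G → ¬ Certificate G
  characterisation⇒¬certificate (v , special , small) c =
    in-v a₁≢b₁ xa₁ xb₁ λ vx → in-v a₂≢b₂ ya₂ yb₂ λ vy → special-¬certificate special c vx vy
    where
    open Certificate c
    in-v : ∀ {w p q} → p ≢ q → Edge w p → Edge w q → ¬ ¬ Reach G v w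
    in-v p≢q wp wq ¬vw = small-component-degree<2 (small _ ¬vw) p≢q wp wq

next : Fin 5 → Fin 5
next 0F = 1F
next 1F = 2F
next 2F = 3F
next 3F = 4F
next 4F = 0F

C₅-twin-free : ∀ i j → i ≡ j ⊎ Σ (Fin 5) λ k → c5adj i k ≢ c5adj j k
C₅-twin-free = from-yes (all? λ i → all? λ j → (i ≟ j) ⊎-dec any? λ k → ¬? (c5adj i k ≟ᵇ c5adj j k))

record Enumeration {n : ℕ} (P : Fin n → Set) : Set where
  constructor enumeration
  field
    size        : ℕ
    elem        : Fin size → Fin n
    elem-injective : ∀ i j → elem i ≡ elem j → i ≡ j
    elem-sound  : ∀ i → P (elem i)
    elem-complete : ∀ u → P u → Σ (Fin size) λ i → elem i ≡ u

enumerate : ∀ {n} (P : Fin n → Set) → (∀ u → Dec (P u)) → Enumeration P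
enumerate {zero}  P P? = enumeration 0 (λ ()) (λ ()) (λ ()) (λ ())
enumerate {suc n} P P? with enumerate (P ∘ suc) (P? ∘ suc) | P? zero
... | enumeration m e e-inj e-sound e-complete | no ¬P0 =
  enumeration m (suc ∘ e) (λ i j → e-inj i j ∘ suc-injective) e-sound complete
  where
  complete : ∀ u → P u → Σ (Fin m) λ i → suc (e i) ≡ u
  complete zero    P0 = contradiction P0 ¬P0
  complete (suc u) Pu = let (i , ei≡u) = e-complete u Pu in i , cong suc ei≡u
... | enumeration m e e-inj e-sound e-complete | yes P0 =
  enumeration (suc m) e′ injective sound complete
  where
  e′ : Fin (suc m) → Fin (suc n)
  e′ zero    = zero
  e′ (suc i) = suc (e i)
  injective : ∀ i j → e′ i ≡ e′ j → i ≡ j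
  injective zero    zero    _ = refl
  injective (suc i) (suc j) h = cong suc (e-inj i j (suc-injective h))
  sound : ∀ i → P (e′ i)
  sound zero    = P0
  sound (suc i) = e-sound i
  complete : ∀ u → P u → Σ (Fin (suc m)) λ i → e′ i ≡ u
  complete zero    _  = zero , refl
  complete (suc u) Pu = let (i , ei≡u) = e-complete u Pu in suc i , cong suc ei≡u

module _ {n : ℕ} (G : Graph n) where
  open Adjacency G

  closed-embedding⇒componentIso :
    ∀ {m} {H : Graph m} (φ : Fin m → Fin n) (i₀ : Fin m) →
    (∀ i j → φ i ≡ φ j → i ≡ j) → (∀ i → Reach G (φ i₀) (φ i)) →
    (∀ i u → Edge (φ i) u → Σ (Fin m) λ j → φ j ≡ u) → (∀ i j → adj H i j ≡ adj G (φ i) (φ j)) →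
    ComponentIso G (φ i₀) H
  closed-embedding⇒componentIso {m} φ i₀ injective reach closed adj≡ =
    φ , (λ {i} {j} → injective i j) , reach , onto , adj≡
    where
    onto : ∀ u → Reach G (φ i₀) u → Σ (Fin m) λ i → φ i ≡ u
    onto u here = i₀ , refl
    onto u (step r e) with onto _ r
    ... | j , refl = closed j u e

  private
    adj-edge : ∀ {u v} → Edge u v → true ≡ adj G u v
    adj-edge = sym

    adj-non-edge : ∀ {u v} → ¬ Edge u v → false ≡ adj G u v
    adj-non-edge = sym ∘ ¬edge⇒adj≡false

    adj-loop : ∀ u → false ≡ adj G u u
    adj-loop u = sym (irrefl G u)

  componentIso-K₁ : ∀ {w} → (∀ u → ¬ Edge w u) → ComponentIso G w K₁
  componentIso-K₁ {w} isolated = closed-embedding⇒componentIso {H = K₁} (λ _ → w) 0F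
    (λ { 0F 0F _ → refl }) (λ _ → here) (λ _ u e → contradiction e (isolated u))
    (λ { 0F 0F → adj-loop w })

  componentIso-K₂ : ∀ {w y} → Edge w y → (∀ u → Edge w u → u ≡ y) → (∀ u → Edge y u → u ≡ w) →
                    ComponentIso G w K₂
  componentIso-K₂ {w} {y} wy N[w] N[y] =
    closed-embedding⇒componentIso {H = K₂} φ 0F injective reach closed adj≡
    where
    φ : Fin 2 → Fin n
    φ 0F = w
    φ 1F = y
    injective : ∀ i j → φ i ≡ φ j → i ≡ j
    injective 0F 0F _ = refl
    injective 0F 1F h = contradiction h (edge⇒≢ wy)
    injective 1F 0F h = contradiction (sym h) (edge⇒≢ wy)
    injective 1F 1F _ = refl
    reach : ∀ i → Reach G w (φ i)
    reach 0F = here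
    reach 1F = step here wy
    closed : ∀ i u → Edge (φ i) u → Σ (Fin 2) λ j → φ j ≡ u
    closed 0F u e = 1F , sym (N[w] u e)
    closed 1F u e = 0F , sym (N[y] u e)
    adj≡ : ∀ i j → k2adj i j ≡ adj G (φ i) (φ j)
    adj≡ 0F 0F = adj-loop w
    adj≡ 0F 1F = adj-edge wy
    adj≡ 1F 0F = adj-edge (edge-sym wy)
    adj≡ 1F 1F = adj-loop y

  componentIso-Star : ∀ {c a b} → a ≢ b → Edge c a → Edge c b → (∀ x → Edge c x → ∀ u → Edge x u → u ≡ c) →
                      Σ ℕ λ k → ComponentIso G c (Star (2 + k))
  componentIso-Star {c} {a} {b} a≢b ca cb leaves with enumerate (Edge c) (edge? c)
  ... | enumeration 0 _ _ _ complete with () ← proj₁ (complete a ca)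
  ... | enumeration 1 _ _ _ complete with complete a ca | complete b cb
  ...   | zero , refl | zero , refl = contradiction refl a≢b
  componentIso-Star {c} a≢b ca cb leaves | enumeration (suc (suc k)) e e-inj ce e-complete =
    k , closed-embedding⇒componentIso {H = Star (2 + k)} φ zero injective reach closed adj≡
    where
    φ : Fin (3 + k) → Fin n
    φ zero    = c
    φ (suc i) = e i
    injective : ∀ i j → φ i ≡ φ j → i ≡ j
    injective zero    zero    _ = refl
    injective zero    (suc j) h = contradiction h (edge⇒≢ (ce j))
    injective (suc i) zero    h = contradiction (sym h) (edge⇒≢ (ce i))
    injective (suc i) (suc j) h = cong suc (e-inj i j h)
    reach : ∀ i → Reach G c (φ i)
    reach zero    = here
    reach (suc i) = step here (ce i)
    closed : ∀ i u → Edge (φ i) u → Σ (Fin (3 + k)) λ j → φ j ≡ u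
    closed zero    u e′ = let (j , ej≡u) = e-complete u e′ in suc j , ej≡u
    closed (suc i) u e′ = zero , sym (leaves (e i) (ce i) u e′)
    adj≡ : ∀ i j → staradj i j ≡ adj G (φ i) (φ j)
    adj≡ zero    zero    = adj-loop c
    adj≡ zero    (suc j) = adj-edge (ce j)
    adj≡ (suc i) zero    = adj-edge (edge-sym (ce i))
    adj≡ (suc i) (suc j) = adj-non-edge (λ eij → edge⇒≢ (ce j) (sym (leaves (e i) (ce i) (e j) eij)))

  componentIso-StarPlus :
    ∀ {c x₁ x₂} → Edge c x₁ → Edge c x₂ → Edge x₁ x₂ →
    (∀ x u → Edge c x → Edge x u → u ≡ c ⊎ (x ≡ x₁ × u ≡ x₂) ⊎ (x ≡ x₂ × u ≡ x₁)) →
    Σ ℕ λ k → ComponentIso G c (StarPlus k)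
  componentIso-StarPlus {c} {x₁} {x₂} cx₁ cx₂ x₁x₂ second-step
    with enumerate (λ u → Edge c u × u ≢ x₁ × u ≢ x₂)
                   (λ u → edge? c u ×-dec ¬? (u ≟ x₁) ×-dec ¬? (u ≟ x₂))
  ... | enumeration k e e-inj e-sound e-complete =
    k , closed-embedding⇒componentIso {H = StarPlus k} φ 0F injective reach closed adj≡
    where
    ce : ∀ i → Edge c (e i)
    ce i = proj₁ (e-sound i)
    e≢x₁ : ∀ i → e i ≢ x₁
    e≢x₁ i = proj₁ (proj₂ (e-sound i))
    e≢x₂ : ∀ i → e i ≢ x₂
    e≢x₂ i = proj₂ (proj₂ (e-sound i))
    c≢x₁ : c ≢ x₁
    c≢x₁ = edge⇒≢ cx₁
    c≢x₂ : c ≢ x₂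
    c≢x₂ = edge⇒≢ cx₂
    x₁≢x₂ : x₁ ≢ x₂
    x₁≢x₂ = edge⇒≢ x₁x₂
    φ : Fin (3 + k) → Fin n
    φ 0F                  = c
    φ 1F                  = x₁
    φ 2F                  = x₂
    φ (suc (suc (suc i))) = e i
    injective : ∀ i j → φ i ≡ φ j → i ≡ j
    injective 0F                  0F                  _ = refl
    injective 0F                  1F                  h = contradiction h c≢x₁
    injective 0F                  2F                  h = contradiction h c≢x₂
    injective 0F                  (suc (suc (suc j))) h = contradiction h (edge⇒≢ (ce j))
    injective 1F                  0F                  h = contradiction (sym h) c≢x₁
    injective 1F                  1F                  _ = refl
    injective 1F                  2F                  h = contradiction h x₁≢x₂
    injective 1F                  (suc (suc (suc j))) h = contradiction (sym h) (e≢x₁ j)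
    injective 2F                  0F                  h = contradiction (sym h) c≢x₂
    injective 2F                  1F                  h = contradiction (sym h) x₁≢x₂
    injective 2F                  2F                  _ = refl
    injective 2F                  (suc (suc (suc j))) h = contradiction (sym h) (e≢x₂ j)
    injective (suc (suc (suc i))) 0F                  h = contradiction (sym h) (edge⇒≢ (ce i))
    injective (suc (suc (suc i))) 1F                  h = contradiction h (e≢x₁ i)
    injective (suc (suc (suc i))) 2F                  h = contradiction h (e≢x₂ i)
    injective (suc (suc (suc i))) (suc (suc (suc j))) h = cong (λ t → suc (suc (suc t))) (e-inj i j h)
    reach : ∀ i → Reach G c (φ i)
    reach 0F                  = here
    reach 1F                  = step here cx₁
    reach 2F                  = step here cx₂
    reach (suc (suc (suc i))) = step here (ce i)
    from-neighbour : ∀ x u → Edge c x → Edge x u → Σ (Fin (3 + k)) λ j → φ j ≡ u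
    from-neighbour x u cx xu with second-step x u cx xu
    ... | inj₁ u≡c               = 0F , sym u≡c
    ... | inj₂ (inj₁ (_ , u≡x₂)) = 2F , sym u≡x₂
    ... | inj₂ (inj₂ (_ , u≡x₁)) = 1F , sym u≡x₁
    closed : ∀ i u → Edge (φ i) u → Σ (Fin (3 + k)) λ j → φ j ≡ u
    closed 0F u cu with u ≟ x₁ | u ≟ x₂
    ... | yes u≡x₁ | _        = 1F , sym u≡x₁
    ... | no _     | yes u≡x₂ = 2F , sym u≡x₂
    ... | no u≢x₁  | no u≢x₂  = let (j , ej≡u) = e-complete u (cu , u≢x₁ , u≢x₂) in suc (suc (suc j)) , ej≡u
    closed 1F                  u e′ = from-neighbour x₁ u cx₁ e′
    closed 2F                  u e′ = from-neighbour x₂ u cx₂ e′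
    closed (suc (suc (suc i))) u e′ = from-neighbour (e i) u (ce i) e′
    non-edge : ∀ {x u} → Edge c x → Edge c u → ¬ (x ≡ x₁ × u ≡ x₂) → ¬ (x ≡ x₂ × u ≡ x₁) →
               false ≡ adj G x u
    non-edge {x} {u} cx cu ¬12 ¬21 = adj-non-edge λ xu → case second-step x u cx xu of λ
      { (inj₁ u≡c)          → edge⇒≢ cu (sym u≡c)
      ; (inj₂ (inj₁ x₁x₂′)) → ¬12 x₁x₂′
      ; (inj₂ (inj₂ x₂x₁′)) → ¬21 x₂x₁′ }
    adj≡ : ∀ i j → starPlusAdj i j ≡ adj G (φ i) (φ j)
    adj≡ 0F                  0F                  = adj-loop c
    adj≡ 0F                  1F                  = adj-edge cx₁
    adj≡ 0F                  2F                  = adj-edge cx₂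
    adj≡ 0F                  (suc (suc (suc j))) = adj-edge (ce j)
    adj≡ 1F                  0F                  = adj-edge (edge-sym cx₁)
    adj≡ 2F                  0F                  = adj-edge (edge-sym cx₂)
    adj≡ (suc (suc (suc i))) 0F                  = adj-edge (edge-sym (ce i))
    adj≡ 1F                  1F                  = adj-loop x₁
    adj≡ 1F                  2F                  = adj-edge x₁x₂
    adj≡ 2F                  1F                  = adj-edge (edge-sym x₁x₂)
    adj≡ 2F                  2F                  = adj-loop x₂
    adj≡ 1F                  (suc (suc (suc j))) = non-edge cx₁ (ce j) (e≢x₂ j ∘ proj₂) (x₁≢x₂ ∘ proj₁)
    adj≡ 2F                  (suc (suc (suc j))) = non-edge cx₂ (ce j) (x₁≢x₂ ∘ sym ∘ proj₁) (e≢x₁ j ∘ proj₂)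
    adj≡ (suc (suc (suc i))) 1F                  = non-edge (ce i) cx₁ (e≢x₁ i ∘ proj₁) (e≢x₂ i ∘ proj₁)
    adj≡ (suc (suc (suc i))) 2F                  = non-edge (ce i) cx₂ (e≢x₁ i ∘ proj₁) (e≢x₂ i ∘ proj₁)
    adj≡ (suc (suc (suc i))) (suc (suc (suc j))) = non-edge (ce i) (ce j) (e≢x₁ i ∘ proj₁) (e≢x₂ i ∘ proj₁)

  sum-embedding⇒componentIso :
    ∀ {a b} {H : Graph (a + b)} (ψ : Fin a ⊎ Fin b → Fin n) (i₀ : Fin (a + b)) →
    (∀ s t → ψ s ≡ ψ t → s ≡ t) → (∀ s → Reach G (ψ (splitAt a i₀)) (ψ s)) →
    (∀ s u → Edge (ψ s) u → Σ (Fin a ⊎ Fin b) λ t → ψ t ≡ u) →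
    (∀ i j → adj H i j ≡ adj G (ψ (splitAt a i)) (ψ (splitAt a j))) →
    ComponentIso G (ψ (splitAt a i₀)) H
  sum-embedding⇒componentIso {a} {b} {H} ψ i₀ ψ-injective ψ-reach ψ-closed adj≡ =
    closed-embedding⇒componentIso {H = H} (ψ ∘ splitAt a) i₀ injective (ψ-reach ∘ splitAt a) closed adj≡
    where
    injective : ∀ i j → ψ (splitAt a i) ≡ ψ (splitAt a j) → i ≡ j
    injective i j h = begin
      i                      ≡⟨ join-splitAt a b i ⟨
      join a b (splitAt a i) ≡⟨ cong (join a b) (ψ-injective (splitAt a i) (splitAt a j) h) ⟩
      join a b (splitAt a j) ≡⟨ join-splitAt a b j ⟩
      j                      ∎
      where open ≡-Reasoning
    closed : ∀ i u → Edge (ψ (splitAt a i)) u → Σ (Fin (a + b)) λ j → ψ (splitAt a j) ≡ u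
    closed i u e = let (t , ψt≡u) = ψ-closed (splitAt a i) u e
                   in join a b t , trans (cong ψ (splitAt-join a b t)) ψt≡u

  componentIso-DoubleStar :
    ∀ {u₀ v₀ v₁ ℓ} → Edge u₀ v₀ → Edge v₀ v₁ → v₁ ≢ u₀ → ¬ Edge u₀ v₁ → Edge u₀ ℓ → ℓ ≢ v₀ →
    (∀ x u → Edge u₀ x → x ≢ v₀ → Edge x u → u ≡ u₀) →
    (∀ u → Edge v₀ u → u ≡ u₀ ⊎ u ≡ v₁) → (∀ u → Edge v₁ u → u ≡ v₀) →
    Σ ℕ λ k → ComponentIso G u₀ (DoubleStar (1 + k) 1)
  componentIso-DoubleStar {u₀} {v₀} {v₁} {ℓ} u₀v₀ v₀v₁ v₁≢u₀ ¬u₀v₁ u₀ℓ ℓ≢v₀ leaves N[v₀] N[v₁]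
    with enumerate (λ u → Edge u₀ u × u ≢ v₀) (λ u → edge? u₀ u ×-dec ¬? (u ≟ v₀))
  ... | enumeration 0 _ _ _ complete with () ← proj₁ (complete ℓ (u₀ℓ , ℓ≢v₀))
  ... | enumeration (suc k) e e-inj e-sound e-complete =
    k , sum-embedding⇒componentIso {H = DoubleStar (1 + k) 1} ψ 0F ψ-injective ψ-reach ψ-closed
          (λ i j → ψ-adj≡ (splitAt (2 + k) i) (splitAt (2 + k) j))
    where
    u₀e : ∀ i → Edge u₀ (e i)
    u₀e i = proj₁ (e-sound i)
    e≢v₀ : ∀ i → e i ≢ v₀
    e≢v₀ i = proj₂ (e-sound i)
    e≢v₁ : ∀ i → e i ≢ v₁
    e≢v₁ i refl = ¬u₀v₁ (u₀e i)
    u₀≢v₀ : u₀ ≢ v₀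
    u₀≢v₀ = edge⇒≢ u₀v₀
    v₀≢v₁ : v₀ ≢ v₁
    v₀≢v₁ = edge⇒≢ v₀v₁
    leaf-edge : ∀ i {u} → Edge (e i) u → u ≡ u₀
    leaf-edge i = leaves (e i) _ (u₀e i) (e≢v₀ i)
    ψ : Fin (2 + k) ⊎ Fin 2 → Fin n
    ψ (inj₁ 0F)      = u₀
    ψ (inj₁ (suc i)) = e i
    ψ (inj₂ 0F)      = v₀
    ψ (inj₂ 1F)      = v₁
    ψ-injective : ∀ s t → ψ s ≡ ψ t → s ≡ t
    ψ-injective (inj₁ 0F)      (inj₁ 0F)      _ = refl
    ψ-injective (inj₁ 0F)      (inj₁ (suc j)) h = contradiction h (edge⇒≢ (u₀e j))
    ψ-injective (inj₁ 0F)      (inj₂ 0F)      h = contradiction h u₀≢v₀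
    ψ-injective (inj₁ 0F)      (inj₂ 1F)      h = contradiction (sym h) v₁≢u₀
    ψ-injective (inj₁ (suc i)) (inj₁ 0F)      h = contradiction (sym h) (edge⇒≢ (u₀e i))
    ψ-injective (inj₁ (suc i)) (inj₁ (suc j)) h = cong (inj₁ ∘ suc) (e-inj i j h)
    ψ-injective (inj₁ (suc i)) (inj₂ 0F)      h = contradiction h (e≢v₀ i)
    ψ-injective (inj₁ (suc i)) (inj₂ 1F)      h = contradiction h (e≢v₁ i)
    ψ-injective (inj₂ 0F)      (inj₁ 0F)      h = contradiction (sym h) u₀≢v₀
    ψ-injective (inj₂ 0F)      (inj₁ (suc j)) h = contradiction (sym h) (e≢v₀ j)
    ψ-injective (inj₂ 0F)      (inj₂ 0F)      _ = refl
    ψ-injective (inj₂ 0F)      (inj₂ 1F)      h = contradiction h v₀≢v₁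
    ψ-injective (inj₂ 1F)      (inj₁ 0F)      h = contradiction h v₁≢u₀
    ψ-injective (inj₂ 1F)      (inj₁ (suc j)) h = contradiction (sym h) (e≢v₁ j)
    ψ-injective (inj₂ 1F)      (inj₂ 0F)      h = contradiction (sym h) v₀≢v₁
    ψ-injective (inj₂ 1F)      (inj₂ 1F)      _ = refl
    ψ-reach : ∀ s → Reach G u₀ (ψ s)
    ψ-reach (inj₁ 0F)      = here
    ψ-reach (inj₁ (suc i)) = step here (u₀e i)
    ψ-reach (inj₂ 0F)      = step here u₀v₀
    ψ-reach (inj₂ 1F)      = step (step here u₀v₀) v₀v₁
    ψ-closed : ∀ s u → Edge (ψ s) u → Σ (Fin (2 + k) ⊎ Fin 2) λ t → ψ t ≡ u
    ψ-closed (inj₁ 0F) u e′ with u ≟ v₀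
    ... | yes u≡v₀ = inj₂ 0F , sym u≡v₀
    ... | no  u≢v₀ = let (j , ej≡u) = e-complete u (e′ , u≢v₀) in inj₁ (suc j) , ej≡u
    ψ-closed (inj₁ (suc i)) u e′ = inj₁ 0F , sym (leaf-edge i e′)
    ψ-closed (inj₂ 0F)      u e′ =
      [ (λ u≡u₀ → inj₁ 0F , sym u≡u₀) , (λ u≡v₁ → inj₂ 1F , sym u≡v₁) ]′ (N[v₀] u e′)
    ψ-closed (inj₂ 1F)      u e′ = inj₂ 0F , sym (N[v₁] u e′)
    ψ-adj≡ : ∀ s t → dsAdj s t ≡ adj G (ψ s) (ψ t)
    ψ-adj≡ (inj₁ 0F)      (inj₁ 0F)      = adj-loop u₀
    ψ-adj≡ (inj₁ 0F)      (inj₁ (suc j)) = adj-edge (u₀e j)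
    ψ-adj≡ (inj₁ 0F)      (inj₂ 0F)      = adj-edge u₀v₀
    ψ-adj≡ (inj₁ 0F)      (inj₂ 1F)      = adj-non-edge ¬u₀v₁
    ψ-adj≡ (inj₁ (suc i)) (inj₁ 0F)      = adj-edge (edge-sym (u₀e i))
    ψ-adj≡ (inj₁ (suc i)) (inj₁ (suc j)) = adj-non-edge (λ eij → edge⇒≢ (u₀e j) (sym (leaf-edge i eij)))
    ψ-adj≡ (inj₁ (suc i)) (inj₂ 0F)      = adj-non-edge (λ eiv₀ → u₀≢v₀ (sym (leaf-edge i eiv₀)))
    ψ-adj≡ (inj₁ (suc i)) (inj₂ 1F)      = adj-non-edge (λ eiv₁ → v₁≢u₀ (leaf-edge i eiv₁))
    ψ-adj≡ (inj₂ 0F)      (inj₁ 0F)      = adj-edge (edge-sym u₀v₀)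
    ψ-adj≡ (inj₂ 0F)      (inj₁ (suc j)) = adj-non-edge λ v₀ej →
      [ (λ ej≡u₀ → edge⇒≢ (u₀e j) (sym ej≡u₀)) , e≢v₁ j ]′ (N[v₀] (e j) v₀ej)
    ψ-adj≡ (inj₂ 0F)      (inj₂ 0F)      = adj-loop v₀
    ψ-adj≡ (inj₂ 0F)      (inj₂ 1F)      = adj-edge v₀v₁
    ψ-adj≡ (inj₂ 1F)      (inj₁ 0F)      = adj-non-edge (λ v₁u₀ → u₀≢v₀ (N[v₁] u₀ v₁u₀))
    ψ-adj≡ (inj₂ 1F)      (inj₁ (suc j)) = adj-non-edge (λ v₁ej → e≢v₀ j (N[v₁] (e j) v₁ej))
    ψ-adj≡ (inj₂ 1F)      (inj₂ 0F)      = adj-edge (edge-sym v₀v₁)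
    ψ-adj≡ (inj₂ 1F)      (inj₂ 1F)      = adj-loop v₁

  record InducedC₅ : Set where
    field
      vertex   : Fin 5 → Fin n
      edge     : ∀ i → Edge (vertex i) (vertex (next i))
      non-edge : ∀ i → ¬ Edge (vertex i) (vertex (next (next i)))

  rotate : InducedC₅ → InducedC₅
  rotate C = record { vertex = vertex ∘ next ; edge = edge ∘ next ; non-edge = non-edge ∘ next }
    where open InducedC₅ C

  module _ (C : InducedC₅) where
    open InducedC₅ C

    inducedC₅-adj : ∀ i j → c5adj i j ≡ adj G (vertex i) (vertex j)
    inducedC₅-adj 0F 0F = adj-loop _
    inducedC₅-adj 0F 1F = adj-edge (edge 0F)
    inducedC₅-adj 0F 2F = adj-non-edge (non-edge 0F)
    inducedC₅-adj 0F 3F = adj-non-edge (non-edge 3F ∘ edge-sym)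
    inducedC₅-adj 0F 4F = adj-edge (edge-sym (edge 4F))
    inducedC₅-adj 1F 0F = adj-edge (edge-sym (edge 0F))
    inducedC₅-adj 1F 1F = adj-loop _
    inducedC₅-adj 1F 2F = adj-edge (edge 1F)
    inducedC₅-adj 1F 3F = adj-non-edge (non-edge 1F)
    inducedC₅-adj 1F 4F = adj-non-edge (non-edge 4F ∘ edge-sym)
    inducedC₅-adj 2F 0F = adj-non-edge (non-edge 0F ∘ edge-sym)
    inducedC₅-adj 2F 1F = adj-edge (edge-sym (edge 1F))
    inducedC₅-adj 2F 2F = adj-loop _
    inducedC₅-adj 2F 3F = adj-edge (edge 2F)
    inducedC₅-adj 2F 4F = adj-non-edge (non-edge 2F)
    inducedC₅-adj 3F 0F = adj-non-edge (non-edge 3F)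
    inducedC₅-adj 3F 1F = adj-non-edge (non-edge 1F ∘ edge-sym)
    inducedC₅-adj 3F 2F = adj-edge (edge-sym (edge 2F))
    inducedC₅-adj 3F 3F = adj-loop _
    inducedC₅-adj 3F 4F = adj-edge (edge 3F)
    inducedC₅-adj 4F 0F = adj-edge (edge 4F)
    inducedC₅-adj 4F 1F = adj-non-edge (non-edge 4F)
    inducedC₅-adj 4F 2F = adj-non-edge (non-edge 2F ∘ edge-sym)
    inducedC₅-adj 4F 3F = adj-edge (edge-sym (edge 3F))
    inducedC₅-adj 4F 4F = adj-loop _

    inducedC₅-injective : ∀ i j → vertex i ≡ vertex j → i ≡ j
    inducedC₅-injective i j vi≡vj with C₅-twin-free i j
    ... | inj₁ i≡j        = i≡j
    ... | inj₂ (k , i≁k≁j) = contradiction (begin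
      c5adj i k                   ≡⟨ inducedC₅-adj i k ⟩
      adj G (vertex i) (vertex k) ≡⟨ cong (λ u → adj G u (vertex k)) vi≡vj ⟩
      adj G (vertex j) (vertex k) ≡⟨ inducedC₅-adj j k ⟨
      c5adj j k                   ∎) i≁k≁j
      where open ≡-Reasoning

    distinct : ∀ i j → i ≢ j → vertex i ≢ vertex j
    distinct i j i≢j = i≢j ∘ inducedC₅-injective i j

    -- A further neighbour r of vertex 0 either shares the neighbours 0 and 3 with vertex 4,
    -- or gives a certificate with zeros 0, 2 and values 1 at vertex 1, 2 at r and at vertex 3.
    inducedC₅-closed : ¬ Certificate G → ∀ r → Edge (vertex 0F) r → r ≡ vertex 1F ⊎ r ≡ vertex 4F
    inducedC₅-closed ¬cert r 0r with r ≟ vertex 1F | r ≟ vertex 4F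
    ... | yes r≡1 | _       = inj₁ r≡1
    ... | no _    | yes r≡4 = inj₂ r≡4
    ... | no r≢1  | no r≢4  with edge? r (vertex 3F)
    ...   | yes r3 = ⊥-elim $ ¬common-neighbour-pair G ¬cert (r≢4 ∘ sym) (distinct 0F 3F (λ ()))
                       (edge 4F) (edge-sym (edge 3F)) (edge-sym 0r) r3
    ...   | no ¬r3 = ⊥-elim $ ¬cert $ certificate-sharing-a G (distinct 0F 2F (λ ()))
                       (edge 0F) 0r (edge-sym (edge 1F)) (edge 2F)
                       (inj₂ ¬r3) (r≢1 ∘ sym) (distinct 1F 3F (λ ()))

  inducedC₅⇒componentIso : ¬ Certificate G → (C : InducedC₅) → ComponentIso G (InducedC₅.vertex C 0F) C₅
  inducedC₅⇒componentIso ¬cert C =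
    closed-embedding⇒componentIso {H = C₅} vertex 0F (inducedC₅-injective C) reach closed (inducedC₅-adj C)
    where
    open InducedC₅ C
    reach : ∀ i → Reach G (vertex 0F) (vertex i)
    reach 0F = here
    reach 1F = step here (edge 0F)
    reach 2F = step (step here (edge 0F)) (edge 1F)
    reach 3F = step (step (step here (edge 0F)) (edge 1F)) (edge 2F)
    reach 4F = step (step (step (step here (edge 0F)) (edge 1F)) (edge 2F)) (edge 3F)
    index : ∀ {r} i j → r ≡ vertex i ⊎ r ≡ vertex j → Σ (Fin 5) λ k → vertex k ≡ r
    index i _ (inj₁ r≡i) = i , sym r≡i
    index _ j (inj₂ r≡j) = j , sym r≡j
    closed : ∀ i r → Edge (vertex i) r → Σ (Fin 5) λ k → vertex k ≡ r
    closed 0F r e = index 1F 4F (inducedC₅-closed C ¬cert r e)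
    closed 1F r e = index 2F 0F (inducedC₅-closed (rotate C) ¬cert r e)
    closed 2F r e = index 3F 1F (inducedC₅-closed (rotate (rotate C)) ¬cert r e)
    closed 3F r e = index 4F 2F (inducedC₅-closed (rotate (rotate (rotate C))) ¬cert r e)
    closed 4F r e = index 0F 3F (inducedC₅-closed (rotate (rotate (rotate (rotate C)))) ¬cert r e)

module Structure {n : ℕ} (G : Graph n) (¬cert : ¬ Certificate G) where
  open Adjacency G

  no-common-pair : ∀ {x y p q} → x ≢ y → p ≢ q → Edge x p → Edge x q → Edge y p → Edge y q → ⊥
  no-common-pair = ¬common-neighbour-pair G ¬cert

  module Rooted {z a b : Fin n} (a≢b : a ≢ b) (za : Edge z a) (zb : Edge z b) where

    -- z with a, b and x with p, q give a certificate, since nothing links the two components.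
    outside-degree<2 : ∀ {x p q} → ¬ Reach G z x → p ≢ q → Edge x p → Edge x q → ⊥
    outside-degree<2 {x} {p} {q} ¬zx p≢q xp xq =
      ¬cert (certificate z x a b p q (¬zx ∘ reach) za zb xp xq
        (inj₂ (¬zp ∘ step (step here za))) (inj₂ (¬zq ∘ step (step here zb)))
        a≢b (λ { refl → ¬zq (step here za) }) (λ { refl → ¬zp (step here zb) }) p≢q)
      where
      reach : ∀ {u} → z ≡ u → Reach G z u
      reach refl = here
      ¬zp : ¬ Reach G z p
      ¬zp zp = ¬zx (step zp (edge-sym xp))
      ¬zq : ¬ Reach G z q
      ¬zq zq = ¬zx (step zq (edge-sym xq))

    outside-component : ∀ w → ¬ Reach G z w → ComponentIso G w K₁ ⊎ ComponentIso G w K₂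
    outside-component w ¬zw with any? (edge? w)
    ... | no ¬nbr        = inj₁ (componentIso-K₁ G (λ u wu → ¬nbr (u , wu)))
    ... | yes (y , wy) = inj₂ (componentIso-K₂ G wy
      (λ u wu → decidable-stable (u ≟ y) λ u≢y → outside-degree<2 ¬zw u≢y wu wy)
      (λ u yu → decidable-stable (u ≟ w) λ u≢w →
         outside-degree<2 (λ zy → ¬zw (step zy (edge-sym wy))) u≢w yu (edge-sym wy)))

    characterisation-via : ∀ {c} → Reach G z c → SpecialComponent G c → Characterisation G
    characterisation-via zc special =
      _ , special , λ w ¬cw → outside-component w (λ zw → ¬cw (reach-trans (reach-sym zc) zw))

    neighbour-besides : ∀ p → Σ (Fin n) λ r → Edge z r × r ≢ p
    neighbour-besides p with a ≟ p
    ... | yes refl = b , zb , a≢b ∘ sym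
    ... | no  a≢p  = a , za , a≢p

    -- With no certificate, the neighbour r ≢ p of z must be adjacent to q, and the five
    -- vertices z, p, y, q, r span an induced 5-cycle.
    pentagon : ∀ {p y q} → Edge z p → Edge p y → ¬ Edge z y → y ≢ z → Edge y q → q ≢ p → Characterisation G
    pentagon {p} {y} {q} zp py ¬zy y≢z yq q≢p with neighbour-besides p
    ... | r , zr , r≢p = characterisation-via here (inj₂ (inj₂ (inj₂ (inducedC₅⇒componentIso G ¬cert C))))
      where
      ¬zq : ¬ Edge z q
      ¬zq zq = no-common-pair (y≢z ∘ sym) (q≢p ∘ sym) zp zq (edge-sym py) yq
      rq : Edge r q
      rq = decidable-stable (edge? r q) λ ¬rq →
             ¬cert (certificate-sharing-a G (y≢z ∘ sym) zp zr (edge-sym py) yq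
                      (inj₂ ¬rq) (r≢p ∘ sym) (q≢p ∘ sym))
      ¬pq : ¬ Edge p q
      ¬pq pq = no-common-pair (λ { refl → ¬zy (edge-sym yq) }) (r≢p ∘ sym) zp zr (edge-sym pq) (edge-sym rq)
      ¬yr : ¬ Edge y r
      ¬yr yr = no-common-pair (y≢z ∘ sym) (r≢p ∘ sym) zp zr (edge-sym py) yr
      ¬rp : ¬ Edge r p
      ¬rp rp = no-common-pair (λ { refl → ¬zy zr }) (q≢p ∘ sym) (edge-sym py) yq rp rq
      vertex : Fin 5 → Fin n
      vertex 0F = z
      vertex 1F = p
      vertex 2F = y
      vertex 3F = q
      vertex 4F = r
      edge : ∀ i → Edge (vertex i) (vertex (next i))
      edge 0F = zp
      edge 1F = py
      edge 2F = yq
      edge 3F = edge-sym rq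
      edge 4F = edge-sym zr
      non-edge : ∀ i → ¬ Edge (vertex i) (vertex (next (next i)))
      non-edge 0F = ¬zy
      non-edge 1F = ¬pq
      non-edge 2F = ¬yr
      non-edge 3F = ¬zq ∘ edge-sym
      non-edge 4F = ¬rp
      C : InducedC₅ G
      C = record { vertex = vertex ; edge = edge ; non-edge = non-edge }

    no-path-in-neighbourhood : ∀ {s t u} → Edge z s → Edge z t → Edge z u → s ≢ u → Edge s t → Edge t u → ⊥
    no-path-in-neighbourhood {s} {t} {u} zs zt zu s≢u st tu with edge? s u
    ... | yes su = no-common-pair (edge⇒≢ st) (edge⇒≢ zu) (edge-sym zs) su (edge-sym zt) tu
    ... | no  _  = no-common-pair s≢u (edge⇒≢ zt) (edge-sym zs) st (edge-sym zu) (edge-sym tu)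

    no-matching-in-neighbourhood : ∀ {x₁ x₂ x₃ x₄} → Edge z x₁ → Edge z x₂ → Edge z x₃ → Edge z x₄ →
                                   Edge x₁ x₂ → Edge x₃ x₄ → x₃ ≢ x₁ → x₃ ≢ x₂ → x₄ ≢ x₁ → x₄ ≢ x₂ → ⊥
    no-matching-in-neighbourhood zx₁ zx₂ zx₃ zx₄ x₁x₂ x₃x₄ x₃≢x₁ x₃≢x₂ x₄≢x₁ x₄≢x₂ =
      ¬cert (certificate-sharing-a G (x₃≢x₁ ∘ sym) (edge-sym zx₁) x₁x₂ (edge-sym zx₃) x₃x₄
        (inj₂ λ x₂x₄ → no-path-in-neighbourhood zx₁ zx₂ zx₄ (x₄≢x₁ ∘ sym) x₁x₂ x₂x₄)
        (edge⇒≢ zx₂) (edge⇒≢ zx₄))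

    -- Without vertices at distance two the component is N[z], and since N(z) contains neither
    -- a path on three vertices nor two disjoint edges, at most one edge joins neighbours of z.
    no-second-layer : (∀ {x u} → Edge z x → Edge x u → u ≡ z ⊎ Edge z u) → Characterisation G
    no-second-layer within with any? (λ x₁ → any? λ x₂ → edge? z x₁ ×-dec edge? z x₂ ×-dec edge? x₁ x₂)
    ... | no ¬edge = characterisation-via here (inj₁ (componentIso-Star G a≢b za zb leaves))
      where
      leaves : ∀ x → Edge z x → ∀ u → Edge x u → u ≡ z
      leaves x zx u xu with within zx xu
      ... | inj₁ u≡z = u≡z
      ... | inj₂ zu  = contradiction (x , u , zx , zu , xu) ¬edge
    ... | yes (x₁ , x₂ , zx₁ , zx₂ , x₁x₂) =
      characterisation-via here (inj₂ (inj₁ (componentIso-StarPlus G zx₁ zx₂ x₁x₂ second-step)))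
      where
      path = no-path-in-neighbourhood
      second-step : ∀ x u → Edge z x → Edge x u → u ≡ z ⊎ (x ≡ x₁ × u ≡ x₂) ⊎ (x ≡ x₂ × u ≡ x₁)
      second-step x u zx xu with within zx xu
      ... | inj₁ u≡z = inj₁ u≡z
      ... | inj₂ zu with x ≟ x₁ | x ≟ x₂ | u ≟ x₁ | u ≟ x₂
      ...   | yes refl | _        | _        | yes refl = inj₂ (inj₁ (refl , refl))
      ...   | yes refl | _        | _        | no u≢x₂  = ⊥-elim (path zu zx₁ zx₂ u≢x₂ (edge-sym xu) x₁x₂)
      ...   | no _     | yes refl | yes refl | _        = inj₂ (inj₂ (refl , refl))
      ...   | no _     | yes refl | no u≢x₁  | _        =
        ⊥-elim (path zu zx₂ zx₁ u≢x₁ (edge-sym xu) (edge-sym x₁x₂))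
      ...   | no _     | no x≢x₂  | yes refl | _        = ⊥-elim (path zx zx₁ zx₂ x≢x₂ xu x₁x₂)
      ...   | no x≢x₁  | no _     | no _     | yes refl = ⊥-elim (path zx zx₂ zx₁ x≢x₁ xu (edge-sym x₁x₂))
      ...   | no x≢x₁  | no x≢x₂  | no u≢x₁  | no u≢x₂  =
        ⊥-elim (no-matching-in-neighbourhood zx₁ zx₂ zx zu x₁x₂ xu x≢x₁ x≢x₂ u≢x₁ u≢x₂)

    SecondLayerPendant : Set
    SecondLayerPendant = ∀ {p y q} → Edge z p → Edge p y → ¬ Edge z y → y ≢ z → Edge y q → q ≡ p

    module SecondLayer (pendant : SecondLayerPendant)
      {p y : Fin n} (zp : Edge z p) (py : Edge p y) (¬zy : ¬ Edge z y) (y≢z : y ≢ z) where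

      y-pendant : ∀ {w} → Edge y w → w ≡ p
      y-pendant = pendant zp py ¬zy y≢z

      -- Two vertices p, p′ carrying the second layer would be zeros sharing the value-1 neighbour z.
      attached : ∀ {p′ y′} → Edge z p′ → Edge p′ y′ → ¬ Edge z y′ → y′ ≢ z → p′ ≡ p
      attached {p′} {y′} zp′ p′y′ ¬zy′ y′≢z = decidable-stable (p′ ≟ p) λ p′≢p →
        ¬cert (certificate-sharing-a G (p′≢p ∘ sym) (edge-sym zp) py (edge-sym zp′) p′y′ y-y′
          (y≢z ∘ sym) (y′≢z ∘ sym))
        where
        y-y′ : IndependentPair y y′
        y-y′ with y ≟ y′
        ... | yes y≡y′ = inj₁ y≡y′
        ... | no  _    = inj₂ λ yy′ → ¬zy′ (subst (Edge z) (sym (y-pendant yy′)) zp)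

      starPlus-at-p : ∀ {q} → Edge z q → Edge p q → Characterisation G
      starPlus-at-p {q} zq pq =
        characterisation-via (step here zp)
          (inj₂ (inj₁ (componentIso-StarPlus G (edge-sym zp) pq zq second-step)))
        where
        N[z] : ∀ {w} → Edge z w → w ≡ p ⊎ w ≡ q
        N[z] {w} zw with w ≟ p | w ≟ q
        ... | yes w≡p | _       = inj₁ w≡p
        ... | no _    | yes w≡q = inj₂ w≡q
        ... | no w≢p  | no w≢q  = ⊥-elim $ ¬cert $ certificate-sharing-a G (edge⇒≢ (edge-sym zp)) pq py zq zw
          (inj₂ (w≢p ∘ y-pendant)) (λ { refl → ¬zy zq }) (w≢q ∘ sym)
        N[q] : ∀ {u} → Edge q u → u ≡ p ⊎ u ≡ z
        N[q] {u} qu with u ≟ z | edge? z u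
        ... | yes u≡z | _       = inj₂ u≡z
        ... | no _    | yes zu  = [ inj₁ , (λ { refl → ⊥-elim (edge-irrefl qu) }) ]′ (N[z] zu)
        ... | no u≢z  | no ¬zu  = ⊥-elim (edge⇒≢ pq (sym (attached zq qu ¬zu u≢z)))
        second-step : ∀ x u → Edge p x → Edge x u → u ≡ p ⊎ (x ≡ z × u ≡ q) ⊎ (x ≡ q × u ≡ z)
        second-step x u px xu with x ≟ z | edge? z x
        ... | yes refl | _ = [ inj₁ , (λ u≡q → inj₂ (inj₁ (refl , u≡q))) ]′ (N[z] xu)
        ... | no x≢z | no ¬zx = inj₁ (pendant zp px ¬zx x≢z xu)
        ... | no x≢z | yes zx with N[z] zx
        ...   | inj₁ refl = ⊥-elim (edge-irrefl px)
        ...   | inj₂ refl = [ inj₁ , (λ u≡z → inj₂ (inj₂ (refl , u≡z))) ]′ (N[q] xu)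

      doubleStar-at-p : ∀ {r y′} → Edge z r → r ≢ p → (∀ {q} → Edge z q → ¬ Edge p q) →
                        Edge p y′ → ¬ Edge z y′ → y′ ≢ z → y′ ≢ y → Characterisation G
      doubleStar-at-p {r} {y′} zr r≢p ¬common py′ ¬zy′ y′≢z y′≢y =
        characterisation-via (step here zp) (inj₂ (inj₂ (inj₁ (componentIso-DoubleStar G
          (edge-sym zp) zr r≢p (¬common zr) py y≢z leaves (λ _ → N[z]) (λ _ → N[r])))))
        where
        leaves : ∀ x u → Edge p x → x ≢ z → Edge x u → u ≡ p
        leaves x u px x≢z xu = pendant zp px (λ zx → ¬common zx px) x≢z xu
        N[z] : ∀ {u} → Edge z u → u ≡ p ⊎ u ≡ r
        N[z] {u} zu with u ≟ p | u ≟ r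
        ... | yes u≡p | _       = inj₁ u≡p
        ... | no _    | yes u≡r = inj₂ u≡r
        ... | no u≢p  | no u≢r  = ⊥-elim $ ¬cert $
          certificate p z y y′ r u (edge⇒≢ (edge-sym zp)) py py′ zr zu
          (inj₂ (r≢p ∘ y-pendant)) (inj₂ (u≢p ∘ pendant zp py′ ¬zy′ y′≢z))
          (y′≢y ∘ sym) (λ { refl → ¬zy zu }) (λ { refl → ¬zy′ zr }) (u≢r ∘ sym)
        N[r] : ∀ {u} → Edge r u → u ≡ z
        N[r] {u} ru with u ≟ z | edge? z u
        ... | yes u≡z | _      = u≡z
        ... | no _    | yes zu = [ (λ { refl → ⊥-elim (¬common zr (edge-sym ru)) })
                                 , (λ { refl → ⊥-elim (edge-irrefl ru) }) ]′ (N[z] zu)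
        ... | no u≢z  | no ¬zu = ⊥-elim (r≢p (attached zr ru ¬zu u≢z))

      doubleStar-at-z : ∀ {r} → Edge z r → r ≢ p → (∀ {q} → Edge z q → ¬ Edge p q) →
                        (∀ {y′} → Edge p y′ → ¬ Edge z y′ → y′ ≢ z → y′ ≡ y) → Characterisation G
      doubleStar-at-z {r} zr r≢p ¬common only-y =
        characterisation-via here (inj₂ (inj₂ (inj₁ (componentIso-DoubleStar G
          zp py y≢z ¬zy zr r≢p leaves (λ _ → N[p]) (λ _ → y-pendant)))))
        where
        leaves : ∀ x u → Edge z x → x ≢ p → Edge x u → u ≡ z
        leaves x u zx x≢p xu with u ≟ z | edge? z u
        ... | yes u≡z | _      = u≡z
        ... | no u≢z  | no ¬zu = ⊥-elim (x≢p (attached zx xu ¬zu u≢z))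
        ... | no _    | yes zu with u ≟ p
        ...   | yes refl = ⊥-elim (¬common zx (edge-sym xu))
        ...   | no u≢p   = ⊥-elim $ ¬cert $
          certificate-sharing-a G (x≢p ∘ sym) (edge-sym zp) py (edge-sym zx) xu
          (inj₂ (u≢p ∘ y-pendant)) (y≢z ∘ sym) (edge⇒≢ zu)
        N[p] : ∀ {u} → Edge p u → u ≡ z ⊎ u ≡ y
        N[p] {u} pu with u ≟ z | edge? z u
        ... | yes u≡z | _      = inj₁ u≡z
        ... | no _    | yes zu = ⊥-elim (¬common zu pu)
        ... | no u≢z  | no ¬zu = inj₂ (only-y pu ¬zu u≢z)

      second-layer : Characterisation G
      second-layer with any? (λ q → edge? z q ×-dec edge? p q) | neighbour-besides p
      ... | yes (q , zq , pq) | _ = starPlus-at-p zq pq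
      ... | no ¬common | r , zr , r≢p
        with any? (λ y′ → edge? p y′ ×-dec ¬? (edge? z y′) ×-dec ¬? (y′ ≟ z) ×-dec ¬? (y′ ≟ y))
      ...   | yes (y′ , py′ , ¬zy′ , y′≢z , y′≢y) =
        doubleStar-at-p zr r≢p (λ zq pq → ¬common (_ , zq , pq)) py′ ¬zy′ y′≢z y′≢y
      ...   | no ¬other = doubleStar-at-z zr r≢p (λ zq pq → ¬common (_ , zq , pq)) λ {y′} py′ ¬zy′ y′≢z →
        decidable-stable (y′ ≟ y) λ y′≢y → ¬other (y′ , py′ , ¬zy′ , y′≢z , y′≢y)

    layered : SecondLayerPendant → Characterisation G
    layered pendant
      with any? (λ p → any? λ y → edge? z p ×-dec edge? p y ×-dec ¬? (edge? z y) ×-dec ¬? (y ≟ z))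
    ... | yes (p , y , zp , py , ¬zy , y≢z) = SecondLayer.second-layer pendant zp py ¬zy y≢z
    ... | no ¬far = no-second-layer within
      where
      within : ∀ {x u} → Edge z x → Edge x u → u ≡ z ⊎ Edge z u
      within {x} {u} zx xu with u ≟ z | edge? z u
      ... | yes u≡z | _      = inj₁ u≡z
      ... | no _    | yes zu = inj₂ zu
      ... | no u≢z  | no ¬zu = contradiction (x , u , zx , xu , ¬zu , u≢z) ¬far

    rooted : Characterisation G
    rooted with any? (λ p → any? λ y → any? λ q → edge? z p ×-dec edge? p y ×-dec ¬? (edge? z y) ×-dec
                                                  ¬? (y ≟ z) ×-dec edge? y q ×-dec ¬? (q ≟ p))
    ... | yes (p , y , q , zp , py , ¬zy , y≢z , yq , q≢p) = pentagon zp py ¬zy y≢z yq q≢p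
    ... | no ¬long-path = layered λ {p} {y} {q} zp py ¬zy y≢z yq →
      decidable-stable (q ≟ p) λ q≢p → ¬long-path (p , y , q , zp , py , ¬zy , y≢z , yq , q≢p)

  characterise : Degree≥2 → Characterisation G
  characterise (_ , _ , _ , a≢b , za , zb) = Rooted.rooted a≢b za zb

degree≥2×¬certificate⇔characterisation : ∀ {n} (G : Graph n) →
                                          (Adjacency.Degree≥2 G × ¬ Certificate G) ⇔ Characterisation G
degree≥2×¬certificate⇔characterisation G = mk⇔
  (λ (degree≥2 , ¬cert) → Structure.characterise G ¬cert degree≥2)
  (λ char → characterisation⇒degree≥2 G char , characterisation⇒¬certificate G char)

theorem4 : ∀ {n : ℕ} (G : Graph n) → 3 ≤ n →
    (γri2≡ G (n ∸ 1) ⇔ Characterisation G)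
theorem4 G (s≤s _) = degree≥2×¬certificate⇔characterisation G ⇔-∘ γri2≡pred⇔ G
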